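{- Let $\mathcal D$ be a valid, weakly stratified set of definitions and $\mathcal I$ a valid, strictly stratified set of inductive definitions, let $p\,\vec x\stackrel{\mu}{=}_{\vec x}B\,p\,\vec x\in\mathcal I$ with $p:\omega$, and let $S:\omega$ be an inductive invariant such that for every tuple $\vec u$ of ground terms of the appropriate types there is a derivation $\Pi_S^{\vec u}$ of $B\,S\,\vec u\vdash S\,\vec u$ in $\text{LD}^{\mu\nabla}_\infty(\mathcal D,\mathcal I)$. Then for every closed term $C$ of type $\omega\to o$ not containing $p$ such that $p$ occurs only positively in $C\,p$ (i.e. no occurrence of $p$ to the left of an implication), and every derivation $\Xi$ in $\text{LD}^{\mu\nabla}_\infty(\mathcal D,\mathcal I)$ of a ground sequent $\Delta\vdash C\,p$, there exists a derivation (denoted $\mu(\Xi,\Pi_S)$) of $\Delta\vdash C\,S$ in $\text{LD}^{\mu\nabla}_\infty(\mathcal D,\mathcal I)$.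
   Context: Terms and formulas. Fix finitely many base types; types are built from base types, a type $o$ of propositions, and arrows. A type is first-order if it does not contain $o$. Terms are simply typed $\lambda$-terms modulo $\alpha\beta\eta$-equality built from the constants of a fixed signature $\Sigma$, from countably many nominal constants of each type, and from variables. $\Sigma$ contains $\bot,\top:o$, $\wedge,\vee,\supset:o\to o\to o$ and $\forall_\alpha,\exists_\alpha,\nabla_\alpha:(\alpha\to o)\to o$ for every first-order type $\alpha$; $Q x.C$ abbreviates $Q(\lambda x.C)$. A formula is a term of type $o$; an atomic formula is $p\,\vec t$ with $p$ a non-logical predicate constant of $\Sigma$. $\mathrm{supp}(F)$ is the finite set of nominal constants occurring in $F$; for a type-preserving permutation $\pi$ of a finite set of nominals containing $\mathrm{supp}(F)$, $F[\pi]$ is $F$ with nominals renamed by $\pi$. A variable context $\mathcal X$ is a finite set of typed variables of first-order types; a term lies over $\mathcal X$ if its free variables are in $\mathcal X$; it is ground if it lies over $\emptyset$ (it may contain nominals); $\mathrm{ground}(\alpha)$ is the set of ground terms of type $\alpha$. A substitution $\theta:\mathcal Y\to\mathcal X$ assigns to each variable of $\mathcal X$ a term over $\mathcal Y$ of the same type; $\epsilon_{\emptyset}$ is the empty substitution. Definitions. A valid set $\mathcal D$ consists of clauses $H\stackrel{\Delta}{=}_{\mathcal X}B$ with $H=p\,\vec t$, $\vec t,B$ over $\mathcal X$ with empty support, every variable of $\mathcal X$ in $H$, and $H$ a higher-order pattern. For $\theta:\mathcal Z\to\mathcal Y$ with empty support, $\mathrm{defn}(H\stackrel{\Delta}{=}_{\mathcal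 X}B,A,\theta,B')$ means there is $\rho:\mathcal Z\to\mathcal X$ with $H\rho=A\theta$ and $B'=B\rho$. Levels: every ground atom $A$ has an ordinal $\mathrm{lvl}(A)$, extended by $\mathrm{lvl}(\bot)=\mathrm{lvl}(\top)=0$, $\max$ for $\wedge,\vee$, $\mathrm{lvl}(A\supset B)=\max(\mathrm{lvl}(A)+1,\mathrm{lvl}(B))$, $\mathrm{lvl}(\forall_\alpha x.C)=\mathrm{lvl}(\exists_\alpha x.C)=\sup_{t\in\mathrm{ground}(\alpha)}\mathrm{lvl}(C[t/x])$, $\mathrm{lvl}(\nabla x.C)=\mathrm{lvl}(C[n/x])$ for fresh $n$. $\mathcal D$ is weakly stratified if $\mathrm{lvl}(H\rho)\ge\mathrm{lvl}(B\rho)$ for all clauses and grounding $\rho$; strictly stratified if moreover $\mathrm{lvl}(p\,\vec t)$ is independent of ground $\vec t$ for each $p$. Inductive definitions. A valid set $\mathcal I$ consists of clauses $p\,\vec x\stackrel{\mu}{=}_{\vec x}B\,p\,\vec x$ with $\vec x$ distinct, $p:\omega$, $B$ a closed term of type $\omega\to\omega$ not containing $p$; each $p$ heads at most one clause of $\mathcal I$ and is not defined in $\mathcal D$. $\mathcal I$ is strictly stratified if its clauses, regarded as clauses $p\,\vec x\stackrel{\Delta}{=}B\,p\,\vec x$, are strictly stratified. An inductive invariant for $p$ is a closed term $S:\omega$. Rules of $\text{LD}^{\mu\nabla}_\infty(\mathcal D,\mathcal I)$ (sequents $\Gamma\vdash C$, $\Gamma$ a finite multiset of ground formulas, $C$ ground):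 $\bot\mathcal L$: $\Gamma,\bot\vdash B$. $\top\mathcal R$: $\Gamma\vdash\top$. $\supset\mathcal L$: from $\Gamma\vdash B$ and $\Gamma,C\vdash D$ infer $\Gamma,B\supset C\vdash D$. $\supset\mathcal R$: from $\Gamma,B\vdash C$ infer $\Gamma\vdash B\supset C$. $\wedge\mathcal L_i$: from $\Gamma,B_i\vdash D$ infer $\Gamma,B_1\wedge B_2\vdash D$. $\wedge\mathcal R$: from $\Gamma\vdash B$ and $\Gamma\vdash C$ infer $\Gamma\vdash B\wedge C$. $\vee\mathcal L$: from $\Gamma,B\vdash D$ and $\Gamma,C\vdash D$ infer $\Gamma,B\vee C\vdash D$. $\vee\mathcal R_i$: from $\Gamma\vdash B_i$ infer $\Gamma\vdash B_1\vee B_2$. $\forall\mathcal L$: from $\Gamma,C[t/x]\vdash D$, $t\in\mathrm{ground}(\tau)$, infer $\Gamma,\forall_\tau x.C\vdash D$. $\forall\mathcal R$: from $\Gamma\vdash C[t/x]$ for every $t\in\mathrm{ground}(\tau)$ infer $\Gamma\vdash\forall_\tau x.C$. $\exists\mathcal L$: from $\Gamma,C[t/x]\vdash D$ for every $t\in\mathrm{ground}(\tau)$ infer $\Gamma,\exists_\tau x.C\vdash D$. $\exists\mathcal R$: from $\Gamma\vdash C[t/x]$, $t\in\mathrm{ground}(\tau)$, infer $\Gamma\vdash\exists_\tau x.C$. $\nabla\mathcal L$/$\nabla\mathcal R$: from $\Gamma,C[n/x]\vdash D$ (resp. $\Gamma\vdash C[n/x]$), $n\notin\mathrm{supp}(C)$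 a nominal, infer $\Gamma,\nabla x.C\vdash D$ (resp. $\Gamma\vdash\nabla x.C$). $c\mathcal L$: from $\Gamma,B,B\vdash C$ infer $\Gamma,B\vdash C$. $w\mathcal L$: from $\Gamma\vdash C$ infer $\Gamma,B\vdash C$. Axiom: $A\vdash A[\pi]$ for $A$ atomic, $\pi$ a permutation of $\mathrm{supp}(A)$. Multicut: from $\Delta_i\vdash A_i$ ($1\le i\le n$, $n\ge0$) and $\Gamma,A_1,\dots,A_n\vdash C$ infer $\Gamma,\Delta_1,\dots,\Delta_n\vdash C$. $\Delta\mathcal L$ ($A=p\,\vec t$, $p$ defined in $\mathcal D$): from premises $\Gamma,B'\vdash C$ for every clause and $B'$ with $\mathrm{defn}(H\stackrel{\Delta}{=}_{\mathcal X}B,A,\epsilon_\emptyset,B')$ infer $\Gamma,A\vdash C$. $\Delta\mathcal R$: from $\Gamma\vdash B'$ infer $\Gamma\vdash A$ when $\mathrm{defn}(H\stackrel{\Delta}{=}_{\mathcal X}B,A,\epsilon_\emptyset,B')$ for some clause. For $q\,\vec x\stackrel{\mu}{=}_{\vec x}B_q\,q\,\vec x\in\mathcal I$: $\mu\mathcal L$: for an invariant $S'$, from $B_q\,S'\,\vec u\vdash S'\,\vec u$ for every ground tuple $\vec u$ and $\Gamma,S'\,\vec t\vdash C$ infer $\Gamma,q\,\vec t\vdash C$; $\mu\mathcal R$: from $\Gamma\vdash B_q\,q\,\vec t$ infer $\Gamma\vdash q\,\vec t$. Derivations are well-founded (possibly infinitely branching) trees built from these rules. -}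

module Defs where

-- Terms modulo alpha-beta-eta are represented by their canonical
-- (beta-normal, eta-long) forms, intrinsically typed, with de Bruijn indices.

open import Data.Nat using (ℕ; zero; suc; _⊔_; _<_; _<ᵇ_)
open import Data.Fin using (Fin)
open import Data.Bool using (Bool; true; false)
open import Data.List using (List; []; _∷_; _++_; map; foldr; concat; tabulate)
open import Data.List.Relation.Unary.All using (All; []; _∷_)
import Data.List.Relation.Unary.All as All
open import Data.List.Relation.Unary.Unique.Propositional using (Unique)
open import Data.List.Membership.Propositional using (_∈_; _∉_)
open import Data.List.Relation.Binary.Permutation.Propositional using (_↭_)
open import Data.Product using (Σ; _,_; _×_; proj₁; proj₂)
open import Data.Sum using (_⊎_)
open import Data.Empty using (⊥)
open import Data.Unit using (⊤)
open import Relation.Binary.PropositionalEquality using (_≡_; _≢_)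
open import Function.Bundles using (_↔_; Inverse)

data _∋_ {A : Set} : List A → A → Set where
  vz : ∀ {a as} → (a ∷ as) ∋ a
  vs : ∀ {a b as} → as ∋ a → (b ∷ as) ∋ a

idx : ∀ {A : Set} {as : List A} {a : A} → as ∋ a → ℕ
idx vz = zero
idx (vs x) = suc (idx x)

data Ord : Set₁ where
  ozero : Ord
  osuc  : Ord → Ord
  osup  : (I : Set) → (I → Ord) → Ord

data _≤o_ : Ord → Ord → Set₁ where
  z≤o  : ∀ {a} → ozero ≤o a
  s≤o  : ∀ {a b} → a ≤o b → osuc a ≤o osuc b
  ≤sup : ∀ {a I f} (i : I) → a ≤o f i → a ≤o osup I f
  sup≤ : ∀ {I f b} → ((i : I) → f i ≤o b) → osup I f ≤o b

_≥o_ : Ord → Ord → Set₁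
a ≥o b = b ≤o a

omax : Ord → Ord → Ord
omax a b = osup Bool (λ { true → a ; false → b })

maxList : List ℕ → ℕ
maxList = foldr _⊔_ 0

-- First-order types over nb base types (types not containing o)

data FTy (nb : ℕ) : Set where
  base : Fin nb → FTy nb
  _⇒_  : FTy nb → FTy nb → FTy nb

infixr 7 _⇒_

-- The logic, over a signature given by
--   Fun ω  : non-logical function constants of first-order type ω
--   Pred ω : non-logical predicate constants of type α₁ → … → αₙ → o  (ω = [α₁,…,αₙ])

module LD {nb : ℕ} (Fun : FTy nb → Set) (Pred : List (FTy nb) → Set) where

  Ty : Set
  Ty = FTy nb

  Ctx : Set
  Ctx = List Ty

  PTy : Set
  PTy = List Ty

  -- heads of canonical terms: variables, constants, nominal constants
  -- (nom n : the n-th nominal constant of type α)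
  data Head (Γ : Ctx) : Ty → Set where
    var : ∀ {α} → Γ ∋ α → Head Γ α
    con : ∀ {α} → Fun α → Head Γ α
    nom : ∀ {α} → ℕ → Head Γ α

  mutual
    data Nf (Γ : Ctx) : Ty → Set where
      lam : ∀ {α β} → Nf (α ∷ Γ) β → Nf Γ (α ⇒ β)
      ne  : ∀ {α b} → Head Γ α → Sp Γ α b → Nf Γ (base b)

    -- spines: Sp Γ α b  applies a head of type α to arguments, giving base type b
    data Sp (Γ : Ctx) : Ty → Fin nb → Set where
      sε  : ∀ {b} → Sp Γ (base b) b
      _▹_ : ∀ {α β b} → Nf Γ α → Sp Γ β b → Sp Γ (α ⇒ β) b

  infixr 5 _▹_

  Ren : Ctx → Ctx → Set
  Ren Γ Δ = ∀ {α} → Γ ∋ α → Δ ∋ α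

  liftR : ∀ {Γ Δ α} → Ren Γ Δ → Ren (α ∷ Γ) (α ∷ Δ)
  liftR ρ vz = vz
  liftR ρ (vs x) = vs (ρ x)

  wkR : ∀ Γ₀ {Δ} → Ren Δ (Γ₀ ++ Δ)
  wkR [] x = x
  wkR (γ ∷ Γ₀) x = vs (wkR Γ₀ x)

  embL : ∀ ω {Γ} → Ren ω (ω ++ Γ)
  embL (a ∷ ω) vz = vz
  embL (a ∷ ω) (vs x) = vs (embL ω x)

  renH : ∀ {Γ Δ α} → Ren Γ Δ → Head Γ α → Head Δ α
  renH ρ (var x) = var (ρ x)
  renH ρ (con c) = con c
  renH ρ (nom n) = nom n

  mutual
    renNf : ∀ {Γ Δ α} → Ren Γ Δ → Nf Γ α → Nf Δ α
    renNf ρ (lam t) = lam (renNf (liftR ρ) t)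
    renNf ρ (ne h sp) = ne (renH ρ h) (renSp ρ sp)

    renSp : ∀ {Γ Δ α b} → Ren Γ Δ → Sp Γ α b → Sp Δ α b
    renSp ρ sε = sε
    renSp ρ (t ▹ sp) = renNf ρ t ▹ renSp ρ sp

  wkNf : ∀ Γ₀ {Δ α} → Nf Δ α → Nf (Γ₀ ++ Δ) α
  wkNf Γ₀ t = renNf (wkR Γ₀) t

  mutual
    etaK : ∀ {Γ} α → (∀ {Δ b} → Ren Γ Δ → Sp Δ α b → Nf Δ (base b)) → Nf Γ α
    etaK (base b) k = k (λ x → x) sε
    etaK (α ⇒ β) k =
      lam (etaK β (λ ρ sp → k (λ x → ρ (vs x)) (etaH α (var (ρ vz)) ▹ sp)))

    etaH : ∀ {Γ} α → Head Γ α → Nf Γ α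
    etaH α h = etaK α (λ ρ sp → ne (renH ρ h) sp)

  nomTm : ∀ {Γ} α → ℕ → Nf Γ α
  nomTm α n = etaH α (nom n)

  data SplitV (Γ₀ : Ctx) (α : Ty) (Δ : Ctx) : Ty → Set where
    here  : SplitV Γ₀ α Δ α
    other : ∀ {β} → (Γ₀ ++ Δ) ∋ β → SplitV Γ₀ α Δ β

  liftS : ∀ {Γ₀ α Δ β γ} → SplitV Γ₀ α Δ β → SplitV (γ ∷ Γ₀) α Δ β
  liftS here = here
  liftS (other y) = other (vs y)

  splitV : ∀ Γ₀ {α Δ β} → (Γ₀ ++ α ∷ Δ) ∋ β → SplitV Γ₀ α Δ β
  splitV [] vz = here
  splitV [] (vs x) = other x
  splitV (γ ∷ Γ₀) vz = other vz
  splitV (γ ∷ Γ₀) (vs x) = liftS (splitV Γ₀ x)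

  mutual
    subNf : ∀ Γ₀ α {Δ β} → Nf Δ α → Nf (Γ₀ ++ α ∷ Δ) β → Nf (Γ₀ ++ Δ) β
    subNf Γ₀ α u (lam {γ} t) = lam (subNf (γ ∷ Γ₀) α u t)
    subNf Γ₀ α u (ne h sp) = subHd Γ₀ α u h sp

    subSp : ∀ Γ₀ α {Δ β b} → Nf Δ α → Sp (Γ₀ ++ α ∷ Δ) β b → Sp (Γ₀ ++ Δ) β b
    subSp Γ₀ α u sε = sε
    subSp Γ₀ α u (t ▹ sp) = subNf Γ₀ α u t ▹ subSp Γ₀ α u sp

    subHd : ∀ Γ₀ α {Δ γ b} → Nf Δ α → Head (Γ₀ ++ α ∷ Δ) γ
          → Sp (Γ₀ ++ α ∷ Δ) γ b → Nf (Γ₀ ++ Δ) (base b)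
    subHd Γ₀ α u (var x) sp = subV Γ₀ α u (splitV Γ₀ x) sp
    subHd Γ₀ α u (con c) sp = ne (con c) (subSp Γ₀ α u sp)
    subHd Γ₀ α u (nom n) sp = ne (nom n) (subSp Γ₀ α u sp)

    subV : ∀ Γ₀ α {Δ γ b} → Nf Δ α → SplitV Γ₀ α Δ γ
         → Sp (Γ₀ ++ α ∷ Δ) γ b → Nf (Γ₀ ++ Δ) (base b)
    subV Γ₀ α u here sp = appSp α (wkNf Γ₀ u) (subSp Γ₀ α u sp)
    subV Γ₀ α u (other y) sp = ne (var y) (subSp Γ₀ α u sp)

    appSp : ∀ {Θ} α {b} → Nf Θ α → Sp Θ α b → Nf Θ (base b)
    appSp (base b) t sε = t
    appSp (α ⇒ β) (lam t) (u ▹ sp) = appSp β (subNf [] α u t) sp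

  -- simultaneous instantiation of the variables ω (variable i := i-th term)
  instTmOpen : ∀ {Γ α} ω → Nf (ω ++ Γ) α → All (Nf Γ) ω → Nf Γ α
  instTmOpen [] t [] = t
  instTmOpen (β ∷ ω) t (u ∷ us) = instTmOpen ω (subNf [] β (wkNf ω u) t) us

  instTm : ∀ {Γ α} ω → Nf ω α → All (Nf Γ) ω → Nf Γ α
  instTm ω t us = instTmOpen ω (renNf (embL ω) t) us

  instArgs : ∀ {Γ ω} X → All (Nf X) ω → All (Nf Γ) X → All (Nf Γ) ω
  instArgs X ts ρ = All.map (λ t → instTm X t ρ) ts

  NRen : Set
  NRen = (α : Ty) → ℕ → ℕ

  permH : ∀ {Γ α} → NRen → Head Γ α → Head Γ α
  permH π (var x) = var x
  permH π (con c) = con c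
  permH {α = α} π (nom n) = nom (π α n)

  mutual
    permNf : ∀ {Γ α} → NRen → Nf Γ α → Nf Γ α
    permNf π (lam t) = lam (permNf π t)
    permNf π (ne h sp) = ne (permH π h) (permSp π sp)

    permSp : ∀ {Γ α b} → NRen → Sp Γ α b → Sp Γ α b
    permSp π sε = sε
    permSp π (t ▹ sp) = permNf π t ▹ permSp π sp

  permArgs : ∀ {Γ ω} → NRen → All (Nf Γ) ω → All (Nf Γ) ω
  permArgs π ts = All.map (λ t → permNf π t) ts

  nomsH : ∀ {Γ α} → Head Γ α → List (Ty × ℕ)
  nomsH (var x) = []
  nomsH (con c) = []
  nomsH {α = α} (nom n) = (α , n) ∷ []

  mutual
    nomsNf : ∀ {Γ α} → Nf Γ α → List (Ty × ℕ)
    nomsNf (lam t) = nomsNf t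
    nomsNf (ne h sp) = nomsH h ++ nomsSp sp

    nomsSp : ∀ {Γ α b} → Sp Γ α b → List (Ty × ℕ)
    nomsSp sε = []
    nomsSp (t ▹ sp) = nomsNf t ++ nomsSp sp

  nomsArgs : ∀ {Γ ω} → All (Nf Γ) ω → List (Ty × ℕ)
  nomsArgs [] = []
  nomsArgs (t ∷ ts) = nomsNf t ++ nomsArgs ts

  occH : ∀ {Γ α γ} → Γ ∋ α → Head Γ γ → Set
  occH x (var y) = idx x ≡ idx y
  occH x (con c) = ⊥
  occH x (nom n) = ⊥

  mutual
    occNf : ∀ {Γ α β} → Γ ∋ α → Nf Γ β → Set
    occNf x (lam t) = occNf (vs x) t
    occNf x (ne h sp) = occH x h ⊎ occSp x sp

    occSp : ∀ {Γ α β b} → Γ ∋ α → Sp Γ β b → Set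
    occSp x sε = ⊥
    occSp x (t ▹ sp) = occNf x t ⊎ occSp x sp

  occArgs : ∀ {Γ α ω} → Γ ∋ α → All (Nf Γ) ω → Set
  occArgs x [] = ⊥
  occArgs x (t ∷ ts) = occNf x t ⊎ occArgs x ts

  -- higher-order patterns.  k = number of variables bound by λ inside the
  -- term being inspected (de Bruijn indices < k); the others are free.
  data BVSp {Γ : Ctx} (k : ℕ) : ∀ {α b} → Sp Γ α b → List ℕ → Set where
    bnil  : ∀ {b} → BVSp k (sε {b = b}) []
    bcons : ∀ {α β b} {sp : Sp Γ β b} {ys} (y : Γ ∋ α) → idx y < k
          → BVSp k sp ys → BVSp k (etaH α (var y) ▹ sp) (idx y ∷ ys)

  mutual
    patNf : ∀ {Γ α} → ℕ → Nf Γ α → Set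
    patNf k (lam t) = patNf (suc k) t
    patNf k (ne (var x) sp) = patVar k sp (idx x <ᵇ k)
    patNf k (ne (con c) sp) = patSp k sp
    patNf k (ne (nom n) sp) = patSp k sp

    patVar : ∀ {Γ α b} → ℕ → Sp Γ α b → Bool → Set
    patVar k sp true = patSp k sp
    patVar k sp false = Σ (List ℕ) (λ ys → BVSp k sp ys × Unique ys)

    patSp : ∀ {Γ α b} → ℕ → Sp Γ α b → Set
    patSp k sε = ⊤
    patSp k (t ▹ sp) = patNf k t × patSp k sp

  patArgs : ∀ {Γ ω} → All (Nf Γ) ω → Set
  patArgs [] = ⊤
  patArgs (t ∷ ts) = patNf 0 t × patArgs ts

  -- Formulas.  Form Π Γ : formulas with predicate variables Π and term
  -- variables Γ.  (Π is used for closed terms of type ω → o or ω → ω,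
  -- i.e. λP.…; ground formulas are Form [] [].)

  infixr 6 _∧F_
  infixr 5 _∨F_
  infixr 4 _⊃F_

  data Form (Π : List PTy) (Γ : Ctx) : Set where
    botF topF : Form Π Γ
    _∧F_ _∨F_ _⊃F_ : Form Π Γ → Form Π Γ → Form Π Γ
    allF exF nabF : (α : Ty) → Form Π (α ∷ Γ) → Form Π Γ
    atom  : ∀ {ω} → Pred ω → All (Nf Γ) ω → Form Π Γ
    patom : ∀ {ω} → Π ∋ ω → All (Nf Γ) ω → Form Π Γ

  GF : Set
  GF = Form [] []

  renF : ∀ {Π Γ Δ} → Ren Γ Δ → Form Π Γ → Form Π Δ
  renF ρ botF = botF
  renF ρ topF = topF
  renF ρ (A ∧F B) = renF ρ A ∧F renF ρ B
  renF ρ (A ∨F B) = renF ρ A ∨F renF ρ B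
  renF ρ (A ⊃F B) = renF ρ A ⊃F renF ρ B
  renF ρ (allF α C) = allF α (renF (liftR ρ) C)
  renF ρ (exF α C) = exF α (renF (liftR ρ) C)
  renF ρ (nabF α C) = nabF α (renF (liftR ρ) C)
  renF ρ (atom p ts) = atom p (All.map (λ t → renNf ρ t) ts)
  renF ρ (patom P ts) = patom P (All.map (λ t → renNf ρ t) ts)

  subF : ∀ {Π} Γ₀ α {Δ} → Nf Δ α → Form Π (Γ₀ ++ α ∷ Δ) → Form Π (Γ₀ ++ Δ)
  subF Γ₀ α u botF = botF
  subF Γ₀ α u topF = topF
  subF Γ₀ α u (A ∧F B) = subF Γ₀ α u A ∧F subF Γ₀ α u B
  subF Γ₀ α u (A ∨F B) = subF Γ₀ α u A ∨F subF Γ₀ α u B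
  subF Γ₀ α u (A ⊃F B) = subF Γ₀ α u A ⊃F subF Γ₀ α u B
  subF Γ₀ α u (allF β C) = allF β (subF (β ∷ Γ₀) α u C)
  subF Γ₀ α u (exF β C) = exF β (subF (β ∷ Γ₀) α u C)
  subF Γ₀ α u (nabF β C) = nabF β (subF (β ∷ Γ₀) α u C)
  subF Γ₀ α u (atom p ts) = atom p (All.map (λ t → subNf Γ₀ α u t) ts)
  subF Γ₀ α u (patom P ts) = patom P (All.map (λ t → subNf Γ₀ α u t) ts)

  _[_/0] : ∀ {Π α} → Form Π (α ∷ []) → Nf [] α → Form Π []
  _[_/0] {α = α} C t = subF [] α t C

  instOpen : ∀ {Π Γ} ω → Form Π (ω ++ Γ) → All (Nf Γ) ω → Form Π Γ
  instOpen [] F [] = F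
  instOpen (α ∷ ω) F (u ∷ us) = instOpen ω (subF [] α (wkNf ω u) F) us

  -- F applied to terms: (λ x⃗. F) u⃗
  inst : ∀ {Π Γ} ω → Form Π ω → All (Nf Γ) ω → Form Π Γ
  inst ω F us = instOpen ω (renF (embL ω) F) us

  instG : ∀ {Π} ω → Form Π ω → All (Nf []) ω → Form Π []
  instG ω F us = inst ω F us

  PVal : PTy → Set
  PVal ω = ∀ {Γ} → All (Nf Γ) ω → Form [] Γ

  predVal : ∀ {ω} → Pred ω → PVal ω
  predVal p ts = atom p ts

  -- a closed term S : ω  (S = λx⃗. body) as a predicate value
  invVal : ∀ {ω} → Form [] ω → PVal ω
  invVal {ω} S ts = inst ω S ts

  substP : ∀ {ω Γ} → Form (ω ∷ []) Γ → PVal ω → Form [] Γ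
  substP botF v = botF
  substP topF v = topF
  substP (A ∧F B) v = substP A v ∧F substP B v
  substP (A ∨F B) v = substP A v ∨F substP B v
  substP (A ⊃F B) v = substP A v ⊃F substP B v
  substP (allF α C) v = allF α (substP C v)
  substP (exF α C) v = exF α (substP C v)
  substP (nabF α C) v = nabF α (substP C v)
  substP (atom p ts) v = atom p ts
  substP (patom vz ts) v = v ts
  substP (patom (vs ()) ts) v

  noms : ∀ {Π Γ} → Form Π Γ → List (Ty × ℕ)
  noms botF = []
  noms topF = []
  noms (A ∧F B) = noms A ++ noms B
  noms (A ∨F B) = noms A ++ noms B
  noms (A ⊃F B) = noms A ++ noms B
  noms (allF α C) = noms C
  noms (exF α C) = noms C
  noms (nabF α C) = noms C
  noms (atom p ts) = nomsArgs ts
  noms (patom P ts) = nomsArgs ts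

  freshN : ∀ {Π Γ} → Form Π Γ → ℕ
  freshN F = suc (maxList (map proj₂ (noms F)))

  PId : Set
  PId = Σ PTy Pred

  NoPred : ∀ {Π Γ} → PId → Form Π Γ → Set
  NoPred q botF = ⊤
  NoPred q topF = ⊤
  NoPred q (A ∧F B) = NoPred q A × NoPred q B
  NoPred q (A ∨F B) = NoPred q A × NoPred q B
  NoPred q (A ⊃F B) = NoPred q A × NoPred q B
  NoPred q (allF α C) = NoPred q C
  NoPred q (exF α C) = NoPred q C
  NoPred q (nabF α C) = NoPred q C
  NoPred q (atom {ω} p ts) = (ω , p) ≢ q
  NoPred q (patom P ts) = ⊤

  HoleFree : ∀ {ω Π Γ} → Form (ω ∷ Π) Γ → Set
  HoleFree botF = ⊤
  HoleFree topF = ⊤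
  HoleFree (A ∧F B) = HoleFree A × HoleFree B
  HoleFree (A ∨F B) = HoleFree A × HoleFree B
  HoleFree (A ⊃F B) = HoleFree A × HoleFree B
  HoleFree (allF α C) = HoleFree C
  HoleFree (exF α C) = HoleFree C
  HoleFree (nabF α C) = HoleFree C
  HoleFree (atom p ts) = ⊤
  HoleFree (patom vz ts) = ⊥
  HoleFree (patom (vs P) ts) = ⊤

  Positive : ∀ {ω Π Γ} → Form (ω ∷ Π) Γ → Set
  Positive botF = ⊤
  Positive topF = ⊤
  Positive (A ∧F B) = Positive A × Positive B
  Positive (A ∨F B) = Positive A × Positive B
  Positive (A ⊃F B) = HoleFree A × Positive B
  Positive (allF α C) = Positive C
  Positive (exF α C) = Positive C
  Positive (nabF α C) = Positive C
  Positive (atom p ts) = ⊤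
  Positive (patom P ts) = ⊤

  LvlAssign : Set₁
  LvlAssign = ∀ {ω} → Pred ω → All (Nf []) ω → Ord

  -- lvlE L F σ = lvl (F σ) for a grounding σ of the free variables of F
  lvlE : LvlAssign → ∀ {Γ} → Form [] Γ → All (Nf []) Γ → Ord
  lvlE L botF σ = ozero
  lvlE L topF σ = ozero
  lvlE L (A ∧F B) σ = omax (lvlE L A σ) (lvlE L B σ)
  lvlE L (A ∨F B) σ = omax (lvlE L A σ) (lvlE L B σ)
  lvlE L (A ⊃F B) σ = omax (osuc (lvlE L A σ)) (lvlE L B σ)
  lvlE L (allF α C) σ = osup (Nf [] α) (λ t → lvlE L C (t ∷ σ))
  lvlE L (exF α C) σ = osup (Nf [] α) (λ t → lvlE L C (t ∷ σ))
  lvlE L {Γ} (nabF α C) σ =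
    lvlE L C (nomTm α (freshN (inst Γ (nabF α C) σ)) ∷ σ)
  lvlE L {Γ} (atom p ts) σ = L p (instArgs Γ ts σ)
  lvlE L (patom () ts) σ

  lvl : LvlAssign → GF → Ord
  lvl L F = lvlE L F []

  record Clause : Set where
    field
      X    : Ctx
      ω    : PTy
      p    : Pred ω
      args : All (Nf X) ω
      body : Form [] X

  pidC : Clause → PId
  pidC c = (Clause.ω c , Clause.p c)

  headG : (c : Clause) → All (Nf []) (Clause.X c) → GF
  headG c ρ = atom (Clause.p c) (instArgs (Clause.X c) (Clause.args c) ρ)

  bodyG : (c : Clause) → All (Nf []) (Clause.X c) → GF
  bodyG c ρ = instG (Clause.X c) (Clause.body c) ρ

  record ValidClause (c : Clause) : Set where
    field
      argsNoNom : nomsArgs (Clause.args c) ≡ []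
      bodyNoNom : noms (Clause.body c) ≡ []
      allVarsInHead : ∀ {α} (x : Clause.X c ∋ α) → occArgs x (Clause.args c)
      headPattern : patArgs (Clause.args c)

  ValidD : ∀ {DI : Set} → (DI → Clause) → Set
  ValidD D = ∀ i → ValidClause (D i)

  WeaklyStratified : LvlAssign → ∀ {DI : Set} → (DI → Clause) → Set₁
  WeaklyStratified L D =
    ∀ i (ρ : All (Nf []) (Clause.X (D i))) → lvl L (headG (D i) ρ) ≥o lvl L (bodyG (D i) ρ)

  -- Inductive clauses  p x⃗ ≜μ B p x⃗ ;  B = λP.λx⃗. body
  record IClause : Set where
    field
      ω    : PTy
      p    : Pred ω
      B    : Form (ω ∷ []) ω

  pidI : IClause → PId
  pidI c = (IClause.ω c , IClause.p c)

  varsFrom : ∀ {Γ} ω → Ren ω Γ → All (Nf Γ) ω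
  varsFrom [] r = []
  varsFrom (α ∷ ω) r = etaH α (var (r vz)) ∷ varsFrom ω (λ x → r (vs x))

  asClause : IClause → Clause
  asClause c = record
    { X = IClause.ω c
    ; ω = IClause.ω c
    ; p = IClause.p c
    ; args = varsFrom (IClause.ω c) (λ x → x)
    ; body = substP (IClause.B c) (predVal (IClause.p c))
    }

  record ValidI {DI II : Set} (D : DI → Clause) (I : II → IClause) : Set where
    field
      bodyNoP : ∀ j → NoPred (pidI (I j)) (IClause.B (I j))
      oneClause : ∀ j j' → pidI (I j) ≡ pidI (I j') → j ≡ j'
      notInD : ∀ i j → pidC (D i) ≢ pidI (I j)

  StrictlyStratifiedI : LvlAssign → ∀ {II : Set} → (II → IClause) → Set₁
  StrictlyStratifiedI L I =
    WeaklyStratified L (λ j → asClause (I j))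
    × (∀ j (ts ts' : All (Nf []) (IClause.ω (I j)))
         → (L (IClause.p (I j)) ts ≤o L (IClause.p (I j)) ts')
         × (L (IClause.p (I j)) ts' ≤o L (IClause.p (I j)) ts))

  BApp : (c : IClause) → PVal (IClause.ω c) → All (Nf []) (IClause.ω c) → GF
  BApp c v us = instG (IClause.ω c) (substP (IClause.B c) v) us

  module Calculus {DI : Set} (D : DI → Clause) {II : Set} (I : II → IClause) where

    DefinedD : PId → Set
    DefinedD q = Σ DI (λ i → pidC (D i) ≡ q)

    infix 2 _⊢_

    data _⊢_ : List GF → GF → Set where
      botL : ∀ {Γ B} → botF ∷ Γ ⊢ B
      topR : ∀ {Γ} → Γ ⊢ topF
      impL : ∀ {Γ B C D} → Γ ⊢ B → C ∷ Γ ⊢ D → (B ⊃F C) ∷ Γ ⊢ D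
      impR : ∀ {Γ B C} → B ∷ Γ ⊢ C → Γ ⊢ B ⊃F C
      andL₁ : ∀ {Γ B C D} → B ∷ Γ ⊢ D → (B ∧F C) ∷ Γ ⊢ D
      andL₂ : ∀ {Γ B C D} → C ∷ Γ ⊢ D → (B ∧F C) ∷ Γ ⊢ D
      andR : ∀ {Γ B C} → Γ ⊢ B → Γ ⊢ C → Γ ⊢ B ∧F C
      orL : ∀ {Γ B C D} → B ∷ Γ ⊢ D → C ∷ Γ ⊢ D → (B ∨F C) ∷ Γ ⊢ D
      orR₁ : ∀ {Γ B C} → Γ ⊢ B → Γ ⊢ B ∨F C
      orR₂ : ∀ {Γ B C} → Γ ⊢ C → Γ ⊢ B ∨F C
      allL : ∀ {Γ τ C D} (t : Nf [] τ) → (C [ t /0]) ∷ Γ ⊢ D → allF τ C ∷ Γ ⊢ D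
      allR : ∀ {Γ τ C} → ((t : Nf [] τ) → Γ ⊢ C [ t /0]) → Γ ⊢ allF τ C
      exL : ∀ {Γ τ C D} → ((t : Nf [] τ) → (C [ t /0]) ∷ Γ ⊢ D) → exF τ C ∷ Γ ⊢ D
      exR : ∀ {Γ τ C} (t : Nf [] τ) → Γ ⊢ C [ t /0] → Γ ⊢ exF τ C
      nabL : ∀ {Γ τ C D} (n : ℕ) → (τ , n) ∉ noms C
           → (C [ nomTm τ n /0]) ∷ Γ ⊢ D → nabF τ C ∷ Γ ⊢ D
      nabR : ∀ {Γ τ C} (n : ℕ) → (τ , n) ∉ noms C
           → Γ ⊢ C [ nomTm τ n /0] → Γ ⊢ nabF τ C
      cL : ∀ {Γ B C} → B ∷ B ∷ Γ ⊢ C → B ∷ Γ ⊢ C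
      wL : ∀ {Γ B C} → Γ ⊢ C → B ∷ Γ ⊢ C
      -- contexts are multisets
      exch : ∀ {Γ Γ' C} → Γ ↭ Γ' → Γ ⊢ C → Γ' ⊢ C
      ax : ∀ {ω} (p : Pred ω) (ts : All (Nf []) ω) (π : (α : Ty) → ℕ ↔ ℕ)
         → (∀ α n → (α , n) ∈ nomsArgs ts → (α , Inverse.to (π α) n) ∈ nomsArgs ts)
         → atom p ts ∷ [] ⊢ atom p (permArgs (λ α → Inverse.to (π α)) ts)
      mcut : ∀ {Γ C} (n : ℕ) (Δs : Fin n → List GF) (As : Fin n → GF)
           → ((i : Fin n) → Δs i ⊢ As i)
           → tabulate As ++ Γ ⊢ C
           → concat (tabulate Δs) ++ Γ ⊢ C
      defL : ∀ {Γ C ω} (p : Pred ω) (ts : All (Nf []) ω) → DefinedD (ω , p)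
           → ((i : DI) (ρ : All (Nf []) (Clause.X (D i)))
                → headG (D i) ρ ≡ atom p ts → bodyG (D i) ρ ∷ Γ ⊢ C)
           → atom p ts ∷ Γ ⊢ C
      defR : ∀ {Γ A} (i : DI) (ρ : All (Nf []) (Clause.X (D i)))
           → headG (D i) ρ ≡ A → Γ ⊢ bodyG (D i) ρ → Γ ⊢ A
      muL : ∀ {Γ C} (j : II) (ts : All (Nf []) (IClause.ω (I j)))
            (S' : Form [] (IClause.ω (I j)))
          → ((us : All (Nf []) (IClause.ω (I j)))
               → BApp (I j) (invVal S') us ∷ [] ⊢ instG (IClause.ω (I j)) S' us)
          → instG (IClause.ω (I j)) S' ts ∷ Γ ⊢ C
          → atom (IClause.p (I j)) ts ∷ Γ ⊢ C
      muR : ∀ {Γ} (j : II) (ts : All (Nf []) (IClause.ω (I j)))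
          → Γ ⊢ BApp (I j) (predVal (IClause.p (I j))) ts
          → Γ ⊢ atom (IClause.p (I j)) ts

{-# OPTIONS --safe #-}

-- Since p occurs only positively in C, the sequent C p ⊢ C S is derivable by induction on C:
-- each connective is matched by its own left and right rule, an occurrence p t⃗ becomes S t⃗
-- by μL with invariant S (whose premises are Π_S), and the p-free antecedents of implications
-- are closed by identity.  A cut of Ξ against this derivation gives Δ ⊢ C S.  The quantifier
-- cases need (C S)[t/x] = (C[t/x]) S, i.e. that instantiating the invariant commutes with
-- substitution; for canonical terms this is the composition lemma of hereditary substitution.

module Submission where

open import Defs
open import Data.Nat using (ℕ; suc; _⊔_; _≤_; _<_; s≤s)
open import Data.Nat.Properties using (m≤m⊔n; m≤n⊔m; m⊔n<o⇒m<o; m⊔n<o⇒n<o; ≤-trans; ≤-refl; n≮n)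
open import Data.List using (List; []; _∷_; _++_; map)
open import Data.List.Properties using (++-identityʳ)
open import Data.List.Relation.Unary.All using (All; []; _∷_)
import Data.List.Relation.Unary.All as All
open import Data.List.Relation.Unary.All.Properties using (map-cong; map-∘; map-id)
import Data.List.Relation.Unary.Any as Any
open import Data.List.Membership.Propositional using (_∈_; _∉_)
open import Data.List.Membership.Propositional.Properties using (∈-map⁺; ∈-++⁺ˡ; ∈-++⁺ʳ)
open import Data.List.Relation.Binary.Permutation.Propositional using (swap; ↭-refl)
open import Data.Product using (_×_; _,_; proj₂)
open import Data.Unit using (tt)
open import Function.Construct.Identity using (↔-id)
open import Relation.Binary.PropositionalEquality

∈⇒≤maxList : ∀ {n ns} → n ∈ ns → n ≤ maxList ns
∈⇒≤maxList {ns = m ∷ ns} (Any.here refl) = m≤m⊔n m (maxList ns)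
∈⇒≤maxList {ns = m ∷ ns} (Any.there n∈ns) = ≤-trans (∈⇒≤maxList n∈ns) (m≤n⊔m m (maxList ns))

suc-maxList-∉ : ∀ {A : Set} (a : A) (xs : List (A × ℕ)) → (a , suc (maxList (map proj₂ xs))) ∉ xs
suc-maxList-∉ a xs a∈xs = n≮n _ (∈⇒≤maxList (∈-map⁺ proj₂ a∈xs))

module Metatheory {nb : ℕ} (Fun : FTy nb → Set) (Pred : List (FTy nb) → Set) where
  open LD Fun Pred
  open ≡-Reasoning

  RenEq : ∀ {Γ Δ} → Ren Γ Δ → Ren Γ Δ → Set
  RenEq {Γ} ρ ρ' = ∀ {β} (x : Γ ∋ β) → ρ x ≡ ρ' x

  liftR-cong : ∀ {Γ Δ α} {ρ ρ' : Ren Γ Δ} → RenEq ρ ρ' → RenEq (liftR {α = α} ρ) (liftR ρ')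
  liftR-cong e vz = refl
  liftR-cong e (vs x) = cong vs (e x)

  renH-cong : ∀ {Γ Δ α} {ρ ρ' : Ren Γ Δ} → RenEq ρ ρ' → (h : Head Γ α) → renH ρ h ≡ renH ρ' h
  renH-cong e (var x) = cong var (e x)
  renH-cong e (con c) = refl
  renH-cong e (nom n) = refl

  mutual
    renNf-cong : ∀ {Γ Δ α} {ρ ρ' : Ren Γ Δ} → RenEq ρ ρ' → (t : Nf Γ α) → renNf ρ t ≡ renNf ρ' t
    renNf-cong e (lam t) = cong lam (renNf-cong (liftR-cong e) t)
    renNf-cong e (ne h sp) = cong₂ ne (renH-cong e h) (renSp-cong e sp)

    renSp-cong : ∀ {Γ Δ α b} {ρ ρ' : Ren Γ Δ} → RenEq ρ ρ' → (sp : Sp Γ α b) → renSp ρ sp ≡ renSp ρ' sp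
    renSp-cong e sε = refl
    renSp-cong e (t ▹ sp) = cong₂ _▹_ (renNf-cong e t) (renSp-cong e sp)

  renH-∘ : ∀ {Γ Δ Θ α} (ρ : Ren Δ Θ) (ρ' : Ren Γ Δ) (h : Head Γ α) → renH ρ (renH ρ' h) ≡ renH (λ x → ρ (ρ' x)) h
  renH-∘ ρ ρ' (var x) = refl
  renH-∘ ρ ρ' (con c) = refl
  renH-∘ ρ ρ' (nom n) = refl

  mutual
    renNf-∘ : ∀ {Γ Δ Θ α} (ρ : Ren Δ Θ) (ρ' : Ren Γ Δ) (t : Nf Γ α) → renNf ρ (renNf ρ' t) ≡ renNf (λ x → ρ (ρ' x)) t
    renNf-∘ ρ ρ' (lam t) =
      cong lam (trans (renNf-∘ (liftR ρ) (liftR ρ') t) (renNf-cong (λ { vz → refl ; (vs x) → refl }) t))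
    renNf-∘ ρ ρ' (ne h sp) = cong₂ ne (renH-∘ ρ ρ' h) (renSp-∘ ρ ρ' sp)

    renSp-∘ : ∀ {Γ Δ Θ α b} (ρ : Ren Δ Θ) (ρ' : Ren Γ Δ) (sp : Sp Γ α b) → renSp ρ (renSp ρ' sp) ≡ renSp (λ x → ρ (ρ' x)) sp
    renSp-∘ ρ ρ' sε = refl
    renSp-∘ ρ ρ' (t ▹ sp) = cong₂ _▹_ (renNf-∘ ρ ρ' t) (renSp-∘ ρ ρ' sp)

  renH-id : ∀ {Γ α} {ρ : Ren Γ Γ} → RenEq ρ (λ x → x) → (h : Head Γ α) → renH ρ h ≡ h
  renH-id e (var x) = cong var (e x)
  renH-id e (con c) = refl
  renH-id e (nom n) = refl

  mutual
    renNf-id : ∀ {Γ α} {ρ : Ren Γ Γ} → RenEq ρ (λ x → x) → (t : Nf Γ α) → renNf ρ t ≡ t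
    renNf-id e (lam t) = cong lam (renNf-id (λ { vz → refl ; (vs x) → cong vs (e x) }) t)
    renNf-id e (ne h sp) = cong₂ ne (renH-id e h) (renSp-id e sp)

    renSp-id : ∀ {Γ α b} {ρ : Ren Γ Γ} → RenEq ρ (λ x → x) → (sp : Sp Γ α b) → renSp ρ sp ≡ sp
    renSp-id e sε = refl
    renSp-id e (t ▹ sp) = cong₂ _▹_ (renNf-id e t) (renSp-id e sp)

  wk : ∀ {Γ α β} → Nf Γ α → Nf (β ∷ Γ) α
  wk = renNf vs

  renNf-liftR-wk : ∀ {Γ Δ α γ} (ρ : Ren Γ Δ) (u : Nf Γ α) → renNf (liftR {α = γ} ρ) (wk u) ≡ wk (renNf ρ u)
  renNf-liftR-wk ρ u = trans (renNf-∘ (liftR ρ) vs u) (sym (renNf-∘ vs ρ u))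

  wkNf-[] : ∀ {Δ α} (u : Nf Δ α) → wkNf [] u ≡ u
  wkNf-[] = renNf-id (λ x → refl)

  wkNf-∷ : ∀ Γ₀ {γ Δ α} (u : Nf Δ α) → wkNf (γ ∷ Γ₀) u ≡ wk (wkNf Γ₀ u)
  wkNf-∷ Γ₀ u = sym (renNf-∘ vs (wkR Γ₀) u)

  -- Ins α Γ Γ' : Γ' is Γ with a variable of type α inserted.  subF Γ₀ substitutes at the
  -- insertion Γ₀ ++ α ∷ Γ; general insertions compose without ++-assoc transports.
  data Ins (α : Ty) : Ctx → Ctx → Set where
    here  : ∀ {Γ} → Ins α Γ (α ∷ Γ)
    there : ∀ {β Γ Γ'} → Ins α Γ Γ' → Ins α (β ∷ Γ) (β ∷ Γ')

  data Split (α : Ty) (Γ : Ctx) : Ty → Set where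
    hit  : Split α Γ α
    miss : ∀ {β} → Γ ∋ β → Split α Γ β

  mapSplit : ∀ {α Γ Δ β} → Ren Γ Δ → Split α Γ β → Split α Δ β
  mapSplit ρ hit = hit
  mapSplit ρ (miss y) = miss (ρ y)

  mapSplit-∘ : ∀ {α Γ Δ Θ β} (ρ : Ren Δ Θ) (ρ' : Ren Γ Δ) (s : Split α Γ β)
             → mapSplit ρ (mapSplit ρ' s) ≡ mapSplit (λ x → ρ (ρ' x)) s
  mapSplit-∘ ρ ρ' hit = refl
  mapSplit-∘ ρ ρ' (miss y) = refl

  mapSplit-id : ∀ {α Γ β} (s : Split α Γ β) → mapSplit (λ x → x) s ≡ s
  mapSplit-id hit = refl
  mapSplit-id (miss y) = refl

  split : ∀ {α Γ Γ' β} → Ins α Γ Γ' → Γ' ∋ β → Split α Γ β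
  split here vz = hit
  split here (vs x) = miss x
  split (there i) vz = miss vz
  split (there i) (vs x) = mapSplit vs (split i x)

  insVar : ∀ {α Γ Γ'} → Ins α Γ Γ' → Γ' ∋ α
  insVar here = vz
  insVar (there i) = vs (insVar i)

  skip : ∀ {α Γ Γ'} → Ins α Γ Γ' → Ren Γ Γ'
  skip here = vs
  skip (there i) = liftR (skip i)

  insAt : ∀ Θ {α Γ} → Ins α (Θ ++ Γ) (Θ ++ α ∷ Γ)
  insAt [] = here
  insAt (γ ∷ Θ) = there (insAt Θ)

  liftIns : ∀ Θ {α Γ Γ'} → Ins α Γ Γ' → Ins α (Θ ++ Γ) (Θ ++ Γ')
  liftIns [] i = i
  liftIns (γ ∷ Θ) i = there (liftIns Θ i)

  split-insVar : ∀ {α Γ Γ'} (i : Ins α Γ Γ') → split i (insVar i) ≡ hit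
  split-insVar here = refl
  split-insVar (there i) = cong (mapSplit vs) (split-insVar i)

  split-skip : ∀ {α Γ Γ' β} (i : Ins α Γ Γ') (y : Γ ∋ β) → split i (skip i y) ≡ miss y
  split-skip here y = refl
  split-skip (there i) vz = refl
  split-skip (there i) (vs y) = cong (mapSplit vs) (split-skip i y)

  mutual
    hsub : ∀ {α Γ Γ' β} → Ins α Γ Γ' → Nf Γ α → Nf Γ' β → Nf Γ β
    hsub i u (lam t) = lam (hsub (there i) (wk u) t)
    hsub i u (ne (var x) sp) = hsubVar (split i x) u (hsubSp i u sp)
    hsub i u (ne (con c) sp) = ne (con c) (hsubSp i u sp)
    hsub i u (ne (nom n) sp) = ne (nom n) (hsubSp i u sp)

    hsubSp : ∀ {α Γ Γ' β b} → Ins α Γ Γ' → Nf Γ α → Sp Γ' β b → Sp Γ β b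
    hsubSp i u sε = sε
    hsubSp i u (t ▹ sp) = hsub i u t ▹ hsubSp i u sp

    hsubVar : ∀ {α Γ γ b} → Split α Γ γ → Nf Γ α → Sp Γ γ b → Nf Γ (base b)
    hsubVar {α} hit u sp = happ α u sp
    hsubVar (miss y) u sp = ne (var y) sp

    happ : ∀ {Γ} α {b} → Nf Γ α → Sp Γ α b → Nf Γ (base b)
    happ (base b) t sε = t
    happ (α ⇒ β) (lam t) (u ▹ sp) = happ β (hsub here u t) sp

  toSplit : ∀ {Γ₀ α Δ β} → SplitV Γ₀ α Δ β → Split α (Γ₀ ++ Δ) β
  toSplit here = hit
  toSplit (other y) = miss y

  toSplit-liftS : ∀ {Γ₀ α Δ β γ} (s : SplitV Γ₀ α Δ β) → toSplit (liftS {γ = γ} s) ≡ mapSplit vs (toSplit s)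
  toSplit-liftS here = refl
  toSplit-liftS (other y) = refl

  toSplit-splitV : ∀ Γ₀ {α Δ β} (x : (Γ₀ ++ α ∷ Δ) ∋ β) → toSplit (splitV Γ₀ x) ≡ split (insAt Γ₀) x
  toSplit-splitV [] vz = refl
  toSplit-splitV [] (vs x) = refl
  toSplit-splitV (γ ∷ Γ₀) vz = refl
  toSplit-splitV (γ ∷ Γ₀) (vs x) = trans (toSplit-liftS (splitV Γ₀ x)) (cong (mapSplit vs) (toSplit-splitV Γ₀ x))

  mutual
    subNf≡hsub : ∀ Γ₀ α {Δ β} (u : Nf Δ α) (t : Nf (Γ₀ ++ α ∷ Δ) β) → subNf Γ₀ α u t ≡ hsub (insAt Γ₀) (wkNf Γ₀ u) t
    subNf≡hsub Γ₀ α u (lam {γ} t) =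
      cong lam (trans (subNf≡hsub (γ ∷ Γ₀) α u t) (cong (λ u' → hsub (insAt (γ ∷ Γ₀)) u' t) (wkNf-∷ Γ₀ u)))
    subNf≡hsub Γ₀ α u (ne (var x) sp) =
      trans (subV≡hsubVar Γ₀ α u (splitV Γ₀ x) sp)
            (cong (λ s → hsubVar s (wkNf Γ₀ u) (hsubSp (insAt Γ₀) (wkNf Γ₀ u) sp)) (toSplit-splitV Γ₀ x))
    subNf≡hsub Γ₀ α u (ne (con c) sp) = cong (ne (con c)) (subSp≡hsubSp Γ₀ α u sp)
    subNf≡hsub Γ₀ α u (ne (nom n) sp) = cong (ne (nom n)) (subSp≡hsubSp Γ₀ α u sp)

    subSp≡hsubSp : ∀ Γ₀ α {Δ β b} (u : Nf Δ α) (sp : Sp (Γ₀ ++ α ∷ Δ) β b)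
                 → subSp Γ₀ α u sp ≡ hsubSp (insAt Γ₀) (wkNf Γ₀ u) sp
    subSp≡hsubSp Γ₀ α u sε = refl
    subSp≡hsubSp Γ₀ α u (t ▹ sp) = cong₂ _▹_ (subNf≡hsub Γ₀ α u t) (subSp≡hsubSp Γ₀ α u sp)

    subV≡hsubVar : ∀ Γ₀ α {Δ γ b} (u : Nf Δ α) (s : SplitV Γ₀ α Δ γ) (sp : Sp (Γ₀ ++ α ∷ Δ) γ b)
                 → subV Γ₀ α u s sp ≡ hsubVar (toSplit s) (wkNf Γ₀ u) (hsubSp (insAt Γ₀) (wkNf Γ₀ u) sp)
    subV≡hsubVar Γ₀ α u here sp =
      trans (appSp≡happ α (wkNf Γ₀ u) (subSp Γ₀ α u sp)) (cong (happ α (wkNf Γ₀ u)) (subSp≡hsubSp Γ₀ α u sp))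
    subV≡hsubVar Γ₀ α u (other y) sp = cong (ne (var y)) (subSp≡hsubSp Γ₀ α u sp)

    appSp≡happ : ∀ {Θ} α {b} (t : Nf Θ α) (sp : Sp Θ α b) → appSp α t sp ≡ happ α t sp
    appSp≡happ (base b) t sε = refl
    appSp≡happ (α ⇒ β) (lam t) (u ▹ sp) =
      trans (appSp≡happ β (subNf [] α u t) sp)
            (cong (λ t' → happ β t' sp) (trans (subNf≡hsub [] α u t) (cong (λ u' → hsub here u' t) (wkNf-[] u))))

  Tracks : ∀ {α Γ Γ' Δ Δ'} → Ins α Γ Γ' → Ins α Δ Δ' → Ren Γ Δ → Ren Γ' Δ' → Set
  Tracks {Γ' = Γ'} i j ρ ρ' = ∀ {γ} (x : Γ' ∋ γ) → split j (ρ' x) ≡ mapSplit ρ (split i x)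

  Tracks-here : ∀ {α Γ Δ} (ρ : Ren Γ Δ) → Tracks (here {α}) here ρ (liftR ρ)
  Tracks-here ρ vz = refl
  Tracks-here ρ (vs y) = refl

  Tracks-there : ∀ {α β Γ Γ' Δ Δ'} {i : Ins α Γ Γ'} {j : Ins α Δ Δ'} {ρ : Ren Γ Δ} {ρ' : Ren Γ' Δ'}
               → Tracks i j ρ ρ' → Tracks (there {β = β} i) (there j) (liftR ρ) (liftR ρ')
  Tracks-there tr vz = refl
  Tracks-there {i = i} {ρ = ρ} tr (vs y) =
    trans (cong (mapSplit vs) (tr y)) (trans (mapSplit-∘ vs ρ (split i y)) (sym (mapSplit-∘ (liftR ρ) vs (split i y))))

  mutual
    renNf-hsub : ∀ {α Γ Γ' Δ Δ' β} {i : Ins α Γ Γ'} {j : Ins α Δ Δ'} {ρ : Ren Γ Δ} {ρ' : Ren Γ' Δ'}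
               → Tracks i j ρ ρ' → (u : Nf Γ α) (t : Nf Γ' β) → renNf ρ (hsub i u t) ≡ hsub j (renNf ρ u) (renNf ρ' t)
    renNf-hsub {j = j} {ρ} {ρ'} tr u (lam t) =
      cong lam (trans (renNf-hsub (Tracks-there tr) (wk u) t)
                      (cong (λ u' → hsub (there j) u' (renNf (liftR ρ') t)) (renNf-liftR-wk ρ u)))
    renNf-hsub {i = i} {ρ = ρ} tr u (ne (var x) sp) =
      trans (renNf-hsubVar ρ (split i x) u (hsubSp i u sp))
            (cong₂ (λ s sp' → hsubVar s (renNf ρ u) sp') (sym (tr x)) (renSp-hsubSp tr u sp))
    renNf-hsub tr u (ne (con c) sp) = cong (ne (con c)) (renSp-hsubSp tr u sp)
    renNf-hsub tr u (ne (nom n) sp) = cong (ne (nom n)) (renSp-hsubSp tr u sp)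

    renSp-hsubSp : ∀ {α Γ Γ' Δ Δ' β b} {i : Ins α Γ Γ'} {j : Ins α Δ Δ'} {ρ : Ren Γ Δ} {ρ' : Ren Γ' Δ'}
                 → Tracks i j ρ ρ' → (u : Nf Γ α) (sp : Sp Γ' β b)
                 → renSp ρ (hsubSp i u sp) ≡ hsubSp j (renNf ρ u) (renSp ρ' sp)
    renSp-hsubSp tr u sε = refl
    renSp-hsubSp tr u (t ▹ sp) = cong₂ _▹_ (renNf-hsub tr u t) (renSp-hsubSp tr u sp)

    renNf-hsubVar : ∀ {α Γ Δ γ b} (ρ : Ren Γ Δ) (s : Split α Γ γ) (u : Nf Γ α) (sp : Sp Γ γ b)
                  → renNf ρ (hsubVar s u sp) ≡ hsubVar (mapSplit ρ s) (renNf ρ u) (renSp ρ sp)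
    renNf-hsubVar {α} ρ hit u sp = renNf-happ ρ α u sp
    renNf-hsubVar ρ (miss y) u sp = refl

    renNf-happ : ∀ {Γ Δ} (ρ : Ren Γ Δ) α {b} (t : Nf Γ α) (sp : Sp Γ α b)
               → renNf ρ (happ α t sp) ≡ happ α (renNf ρ t) (renSp ρ sp)
    renNf-happ ρ (base b) t sε = refl
    renNf-happ ρ (α ⇒ β) (lam t) (v ▹ sp) =
      trans (renNf-happ ρ β (hsub here v t) sp)
            (cong (λ t' → happ β t' (renSp ρ sp)) (renNf-hsub (Tracks-here ρ) v t))

  hsub-wk : ∀ {α Γ Γ' β γ} (i : Ins α Γ Γ') (u : Nf Γ α) (v : Nf Γ' β)
          → hsub (there {β = γ} i) (wk u) (wk v) ≡ wk (hsub i u v)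
  hsub-wk i u v = sym (renNf-hsub (λ x → refl) u v)

  Avoids : ∀ {α Γ Γ' Θ} → Ins α Γ Γ' → Ren Θ Γ' → Ren Θ Γ → Set
  Avoids {Θ = Θ} i ρ ρ' = ∀ {γ} (x : Θ ∋ γ) → split i (ρ x) ≡ miss (ρ' x)

  Avoids-there : ∀ {α β Γ Γ' Θ} {i : Ins α Γ Γ'} {ρ : Ren Θ Γ'} {ρ' : Ren Θ Γ}
               → Avoids i ρ ρ' → Avoids (there i) (liftR {α = β} ρ) (liftR ρ')
  Avoids-there av vz = refl
  Avoids-there av (vs y) = cong (mapSplit vs) (av y)

  mutual
    hsub-renNf : ∀ {α Γ Γ' Θ β} {i : Ins α Γ Γ'} {ρ : Ren Θ Γ'} {ρ' : Ren Θ Γ}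
               → Avoids i ρ ρ' → (u : Nf Γ α) (t : Nf Θ β) → hsub i u (renNf ρ t) ≡ renNf ρ' t
    hsub-renNf av u (lam t) = cong lam (hsub-renNf (Avoids-there av) (wk u) t)
    hsub-renNf av u (ne (var x) sp) = cong₂ (λ s sp' → hsubVar s u sp') (av x) (hsubSp-renSp av u sp)
    hsub-renNf av u (ne (con c) sp) = cong (ne (con c)) (hsubSp-renSp av u sp)
    hsub-renNf av u (ne (nom n) sp) = cong (ne (nom n)) (hsubSp-renSp av u sp)

    hsubSp-renSp : ∀ {α Γ Γ' Θ β b} {i : Ins α Γ Γ'} {ρ : Ren Θ Γ'} {ρ' : Ren Θ Γ}
                 → Avoids i ρ ρ' → (u : Nf Γ α) (sp : Sp Θ β b) → hsubSp i u (renSp ρ sp) ≡ renSp ρ' sp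
    hsubSp-renSp av u sε = refl
    hsubSp-renSp av u (t ▹ sp) = cong₂ _▹_ (hsub-renNf av u t) (hsubSp-renSp av u sp)

  hsub-skip : ∀ {α Γ Γ' β} (i : Ins α Γ Γ') (u : Nf Γ α) (t : Nf Γ β) → hsub i u (renNf (skip i) t) ≡ t
  hsub-skip i u t = trans (hsub-renNf (split-skip i) u t) (renNf-id (λ x → refl) t)

  data InsView {α Γ Γ'} (i : Ins α Γ Γ') : ∀ {β} → Γ' ∋ β → Set where
    inserted : InsView i (insVar i)
    skipped  : ∀ {β} (z : Γ ∋ β) → InsView i (skip i z)

  insView : ∀ {α Γ Γ' β} (i : Ins α Γ Γ') (x : Γ' ∋ β) → InsView i x
  insView here vz = inserted
  insView here (vs z) = skipped z
  insView (there i) vz = skipped vz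
  insView (there i) (vs y) with insView i y
  ... | inserted = inserted
  ... | skipped z = skipped (vs z)

  -- The variables of Θ ++ α₁ ∷ Γ': the one substituted first, the one inserted by i, and the rest.
  data CompView (Θ : Ctx) (α₁ : Ty) {α₂ Γ Γ'} (i : Ins α₂ Γ Γ') : ∀ {β} → (Θ ++ α₁ ∷ Γ') ∋ β → Set where
    inner : CompView Θ α₁ i (insVar (insAt Θ))
    outer : CompView Θ α₁ i (skip (insAt Θ) (insVar (liftIns Θ i)))
    rest  : ∀ {β} (z : (Θ ++ Γ) ∋ β) → CompView Θ α₁ i (skip (insAt Θ) (skip (liftIns Θ i) z))

  compView : ∀ Θ {α₁ α₂ Γ Γ' β} (i : Ins α₂ Γ Γ') (x : (Θ ++ α₁ ∷ Γ') ∋ β) → CompView Θ α₁ i x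
  compView [] i vz = inner
  compView [] i (vs y) with insView i y
  ... | inserted = outer
  ... | skipped z = rest z
  compView (γ ∷ Θ) i vz = rest vz
  compView (γ ∷ Θ) i (vs y) with compView Θ i y
  ... | inner = inner
  ... | outer = outer
  ... | rest z = rest (vs z)

  split-inner : ∀ Θ {α₁ α₂ Γ Γ'} (i : Ins α₂ Γ Γ')
              → split (liftIns Θ (there {β = α₁} i)) (insVar (insAt Θ {α₁} {Γ'})) ≡ miss (insVar (insAt Θ {α₁} {Γ}))
  split-inner [] i = refl
  split-inner (γ ∷ Θ) i = cong (mapSplit vs) (split-inner Θ i)

  split-outer : ∀ Θ {α₁ α₂ Γ Γ'} (i : Ins α₂ Γ Γ')
              → split (liftIns Θ (there {β = α₁} i)) (skip (insAt Θ {α₁} {Γ'}) (insVar (liftIns Θ i))) ≡ hit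
  split-outer [] i = cong (mapSplit vs) (split-insVar i)
  split-outer (γ ∷ Θ) i = cong (mapSplit vs) (split-outer Θ i)

  split-rest : ∀ Θ {α₁ α₂ Γ Γ' β} (i : Ins α₂ Γ Γ') (z : (Θ ++ Γ) ∋ β)
             → split (liftIns Θ (there {β = α₁} i)) (skip (insAt Θ {α₁} {Γ'}) (skip (liftIns Θ i) z))
               ≡ miss (skip (insAt Θ {α₁} {Γ}) z)
  split-rest [] i z = cong (mapSplit vs) (split-skip i z)
  split-rest (γ ∷ Θ) i vz = refl
  split-rest (γ ∷ Θ) i (vs z) = cong (mapSplit vs) (split-rest Θ i z)

  mutual
    hsub-hsub : ∀ Θ {α₁ α₂ Γ Γ' β} (i : Ins α₂ Γ Γ') (u : Nf (Θ ++ Γ) α₂) (v : Nf (Θ ++ Γ') α₁) (t : Nf (Θ ++ α₁ ∷ Γ') β)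
      → hsub (liftIns Θ i) u (hsub (insAt Θ) v t)
        ≡ hsub (insAt Θ) (hsub (liftIns Θ i) u v) (hsub (liftIns Θ (there i)) (renNf (skip (insAt Θ)) u) t)
    hsub-hsub Θ i u v (lam {γ} t) = cong lam (trans (hsub-hsub (γ ∷ Θ) i (wk u) (wk v) t)
      (cong₂ (λ v' u' → hsub (there (insAt Θ)) v' (hsub (liftIns (γ ∷ Θ) (there i)) u' t))
             (hsub-wk (liftIns Θ i) u v) (renNf-liftR-wk (skip (insAt Θ)) u)))
    hsub-hsub Θ i u v (ne (var x) sp) = hsub-hsub-var Θ i u v (compView Θ i x) sp
    hsub-hsub Θ i u v (ne (con c) sp) = cong (ne (con c)) (hsubSp-hsubSp Θ i u v sp)
    hsub-hsub Θ i u v (ne (nom n) sp) = cong (ne (nom n)) (hsubSp-hsubSp Θ i u v sp)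

    hsubSp-hsubSp : ∀ Θ {α₁ α₂ Γ Γ' β b} (i : Ins α₂ Γ Γ') (u : Nf (Θ ++ Γ) α₂) (v : Nf (Θ ++ Γ') α₁)
      (sp : Sp (Θ ++ α₁ ∷ Γ') β b)
      → hsubSp (liftIns Θ i) u (hsubSp (insAt Θ) v sp)
        ≡ hsubSp (insAt Θ) (hsub (liftIns Θ i) u v) (hsubSp (liftIns Θ (there i)) (renNf (skip (insAt Θ)) u) sp)
    hsubSp-hsubSp Θ i u v sε = refl
    hsubSp-hsubSp Θ i u v (t ▹ sp) = cong₂ _▹_ (hsub-hsub Θ i u v t) (hsubSp-hsubSp Θ i u v sp)

    hsub-hsub-var : ∀ Θ {α₁ α₂ Γ Γ' γ b} (i : Ins α₂ Γ Γ') (u : Nf (Θ ++ Γ) α₂) (v : Nf (Θ ++ Γ') α₁)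
      {x : (Θ ++ α₁ ∷ Γ') ∋ γ} → CompView Θ α₁ i x → (sp : Sp (Θ ++ α₁ ∷ Γ') γ b)
      → hsub (liftIns Θ i) u (hsub (insAt Θ) v (ne (var x) sp))
        ≡ hsub (insAt Θ) (hsub (liftIns Θ i) u v) (hsub (liftIns Θ (there i)) (renNf (skip (insAt Θ)) u) (ne (var x) sp))
    hsub-hsub-var Θ {α₁} i u v inner sp = begin
        hsub L u (hsubVar (split A (insVar A)) v (hsubSp A v sp))
      ≡⟨ cong (λ s → hsub L u (hsubVar s v (hsubSp A v sp))) (split-insVar A) ⟩
        hsub L u (happ α₁ v (hsubSp A v sp))
      ≡⟨ hsub-happ L u α₁ v (hsubSp A v sp) ⟩
        happ α₁ v' (hsubSp L u (hsubSp A v sp))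
      ≡⟨ cong (happ α₁ v') (hsubSp-hsubSp Θ i u v sp) ⟩
        happ α₁ v' (hsubSp A v' sp')
      ≡⟨ cong (λ s → hsubVar s v' (hsubSp A v' sp')) (sym (split-insVar A)) ⟩
        hsub A v' (ne (var (insVar A)) sp')
      ≡⟨ cong (λ s → hsub A v' (hsubVar s u' sp')) (sym (split-inner Θ i)) ⟩
        hsub A v' (hsubVar (split L' (insVar A)) u' sp')
      ∎
      where
        L = liftIns Θ i
        A = insAt Θ
        L' = liftIns Θ (there i)
        u' = renNf (skip A) u
        v' = hsub L u v
        sp' = hsubSp L' u' sp
    hsub-hsub-var Θ {α₂ = α₂} i u v outer sp = begin
        hsub L u (hsubVar (split A (skip A (insVar L))) v (hsubSp A v sp))
      ≡⟨ cong (λ s → hsub L u (hsubVar s v (hsubSp A v sp))) (split-skip A (insVar L)) ⟩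
        hsubVar (split L (insVar L)) u (hsubSp L u (hsubSp A v sp))
      ≡⟨ cong (λ s → hsubVar s u (hsubSp L u (hsubSp A v sp))) (split-insVar L) ⟩
        happ α₂ u (hsubSp L u (hsubSp A v sp))
      ≡⟨ cong (happ α₂ u) (hsubSp-hsubSp Θ i u v sp) ⟩
        happ α₂ u (hsubSp A v' sp')
      ≡⟨ cong (λ u'' → happ α₂ u'' (hsubSp A v' sp')) (sym (hsub-skip A v' u)) ⟩
        happ α₂ (hsub A v' u') (hsubSp A v' sp')
      ≡⟨ sym (hsub-happ A v' α₂ u' sp') ⟩
        hsub A v' (happ α₂ u' sp')
      ≡⟨ cong (λ s → hsub A v' (hsubVar s u' sp')) (sym (split-outer Θ i)) ⟩
        hsub A v' (hsubVar (split L' (skip A (insVar L))) u' sp')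
      ∎
      where
        L = liftIns Θ i
        A = insAt Θ
        L' = liftIns Θ (there i)
        u' = renNf (skip A) u
        v' = hsub L u v
        sp' = hsubSp L' u' sp
    hsub-hsub-var Θ i u v (rest z) sp = begin
        hsub L u (hsubVar (split A (skip A (skip L z))) v (hsubSp A v sp))
      ≡⟨ cong (λ s → hsub L u (hsubVar s v (hsubSp A v sp))) (split-skip A (skip L z)) ⟩
        hsubVar (split L (skip L z)) u (hsubSp L u (hsubSp A v sp))
      ≡⟨ cong (λ s → hsubVar s u (hsubSp L u (hsubSp A v sp))) (split-skip L z) ⟩
        ne (var z) (hsubSp L u (hsubSp A v sp))
      ≡⟨ cong (ne (var z)) (hsubSp-hsubSp Θ i u v sp) ⟩
        ne (var z) (hsubSp A v' sp')
      ≡⟨ cong (λ s → hsubVar s v' (hsubSp A v' sp')) (sym (split-skip A z)) ⟩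
        hsub A v' (ne (var (skip A z)) sp')
      ≡⟨ cong (λ s → hsub A v' (hsubVar s u' sp')) (sym (split-rest Θ i z)) ⟩
        hsub A v' (hsubVar (split L' (skip A (skip L z))) u' sp')
      ∎
      where
        L = liftIns Θ i
        A = insAt Θ
        L' = liftIns Θ (there i)
        u' = renNf (skip A) u
        v' = hsub L u v
        sp' = hsubSp L' u' sp

    hsub-happ : ∀ {α Γ Γ'} (i : Ins α Γ Γ') (u : Nf Γ α) γ {b} (w : Nf Γ' γ) (sp : Sp Γ' γ b)
              → hsub i u (happ γ w sp) ≡ happ γ (hsub i u w) (hsubSp i u sp)
    hsub-happ i u (base b) w sε = refl
    hsub-happ i u (γ₁ ⇒ γ₂) (lam t) (v ▹ sp) =
      trans (hsub-happ i u γ₂ (hsub here v t) sp)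
            (cong (λ t' → happ γ₂ t' (hsubSp i u sp)) (hsub-hsub [] i u v t))

  hsubF : ∀ {Π α Γ Γ'} → Ins α Γ Γ' → Nf Γ α → Form Π Γ' → Form Π Γ
  hsubF i u botF = botF
  hsubF i u topF = topF
  hsubF i u (A ∧F B) = hsubF i u A ∧F hsubF i u B
  hsubF i u (A ∨F B) = hsubF i u A ∨F hsubF i u B
  hsubF i u (A ⊃F B) = hsubF i u A ⊃F hsubF i u B
  hsubF i u (allF β C) = allF β (hsubF (there i) (wk u) C)
  hsubF i u (exF β C) = exF β (hsubF (there i) (wk u) C)
  hsubF i u (nabF β C) = nabF β (hsubF (there i) (wk u) C)
  hsubF i u (atom p ts) = atom p (All.map (hsub i u) ts)
  hsubF i u (patom P ts) = patom P (All.map (hsub i u) ts)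

  mutual
    subF≡hsubF : ∀ {Π} Γ₀ α {Δ} (u : Nf Δ α) (F : Form Π (Γ₀ ++ α ∷ Δ))
               → subF Γ₀ α u F ≡ hsubF (insAt Γ₀) (wkNf Γ₀ u) F
    subF≡hsubF Γ₀ α u botF = refl
    subF≡hsubF Γ₀ α u topF = refl
    subF≡hsubF Γ₀ α u (A ∧F B) = cong₂ _∧F_ (subF≡hsubF Γ₀ α u A) (subF≡hsubF Γ₀ α u B)
    subF≡hsubF Γ₀ α u (A ∨F B) = cong₂ _∨F_ (subF≡hsubF Γ₀ α u A) (subF≡hsubF Γ₀ α u B)
    subF≡hsubF Γ₀ α u (A ⊃F B) = cong₂ _⊃F_ (subF≡hsubF Γ₀ α u A) (subF≡hsubF Γ₀ α u B)
    subF≡hsubF Γ₀ α u (allF β C) = cong (allF β) (subF≡hsubF-under Γ₀ α u C)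
    subF≡hsubF Γ₀ α u (exF β C) = cong (exF β) (subF≡hsubF-under Γ₀ α u C)
    subF≡hsubF Γ₀ α u (nabF β C) = cong (nabF β) (subF≡hsubF-under Γ₀ α u C)
    subF≡hsubF Γ₀ α u (atom p ts) = cong (atom p) (map-cong ts (subNf≡hsub Γ₀ α u))
    subF≡hsubF Γ₀ α u (patom P ts) = cong (patom P) (map-cong ts (subNf≡hsub Γ₀ α u))

    subF≡hsubF-under : ∀ {Π} Γ₀ α {Δ β} (u : Nf Δ α) (C : Form Π (β ∷ Γ₀ ++ α ∷ Δ))
                     → subF (β ∷ Γ₀) α u C ≡ hsubF (there (insAt Γ₀)) (wk (wkNf Γ₀ u)) C
    subF≡hsubF-under Γ₀ α {β = β} u C =
      trans (subF≡hsubF (β ∷ Γ₀) α u C) (cong (λ u' → hsubF (insAt (β ∷ Γ₀)) u' C) (wkNf-∷ Γ₀ u))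

  subF≡hsubF-here : ∀ {Π α Δ} (u : Nf Δ α) (F : Form Π (α ∷ Δ)) → subF [] α u F ≡ hsubF here u F
  subF≡hsubF-here {α = α} u F = trans (subF≡hsubF [] α u F) (cong (λ u' → hsubF here u' F) (wkNf-[] u))

  map-∘-cong : ∀ {A : Set} {P Q Q' R : A → Set}
               (g : ∀ {x} → Q x → R x) (f : ∀ {x} → P x → Q x) (g' : ∀ {x} → Q' x → R x) (f' : ∀ {x} → P x → Q' x)
             → (∀ {x} (p : P x) → g (f p) ≡ g' (f' p))
             → ∀ {xs} (ps : All P xs) → All.map g (All.map f ps) ≡ All.map g' (All.map f' ps)
  map-∘-cong g f g' f' e ps = trans (map-∘ ps) (trans (map-cong ps e) (sym (map-∘ ps)))

  mutual
    hsubF-hsubF : ∀ Θ {Π α₁ α₂ Γ Γ'} (i : Ins α₂ Γ Γ') (u : Nf (Θ ++ Γ) α₂) (v : Nf (Θ ++ Γ') α₁)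
      (F : Form Π (Θ ++ α₁ ∷ Γ'))
      → hsubF (liftIns Θ i) u (hsubF (insAt Θ) v F)
        ≡ hsubF (insAt Θ) (hsub (liftIns Θ i) u v) (hsubF (liftIns Θ (there i)) (renNf (skip (insAt Θ)) u) F)
    hsubF-hsubF Θ i u v botF = refl
    hsubF-hsubF Θ i u v topF = refl
    hsubF-hsubF Θ i u v (A ∧F B) = cong₂ _∧F_ (hsubF-hsubF Θ i u v A) (hsubF-hsubF Θ i u v B)
    hsubF-hsubF Θ i u v (A ∨F B) = cong₂ _∨F_ (hsubF-hsubF Θ i u v A) (hsubF-hsubF Θ i u v B)
    hsubF-hsubF Θ i u v (A ⊃F B) = cong₂ _⊃F_ (hsubF-hsubF Θ i u v A) (hsubF-hsubF Θ i u v B)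
    hsubF-hsubF Θ i u v (allF β C) = cong (allF β) (hsubF-hsubF-under Θ i u v C)
    hsubF-hsubF Θ i u v (exF β C) = cong (exF β) (hsubF-hsubF-under Θ i u v C)
    hsubF-hsubF Θ i u v (nabF β C) = cong (nabF β) (hsubF-hsubF-under Θ i u v C)
    hsubF-hsubF Θ i u v (atom p ts) = cong (atom p) (map-∘-cong _ _ _ _ (hsub-hsub Θ i u v) ts)
    hsubF-hsubF Θ i u v (patom P ts) = cong (patom P) (map-∘-cong _ _ _ _ (hsub-hsub Θ i u v) ts)

    hsubF-hsubF-under : ∀ Θ {Π α₁ α₂ Γ Γ' β} (i : Ins α₂ Γ Γ') (u : Nf (Θ ++ Γ) α₂) (v : Nf (Θ ++ Γ') α₁)
      (C : Form Π (β ∷ Θ ++ α₁ ∷ Γ'))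
      → hsubF (there (liftIns Θ i)) (wk u) (hsubF (there (insAt Θ)) (wk v) C)
        ≡ hsubF (there (insAt Θ)) (wk (hsub (liftIns Θ i) u v))
                (hsubF (there (liftIns Θ (there i))) (wk (renNf (skip (insAt Θ)) u)) C)
    hsubF-hsubF-under Θ {β = β} i u v C = trans (hsubF-hsubF (β ∷ Θ) i (wk u) (wk v) C)
      (cong₂ (λ v' u' → hsubF (there (insAt Θ)) v' (hsubF (liftIns (β ∷ Θ) (there i)) u' C))
             (hsub-wk (liftIns Θ i) u v) (renNf-liftR-wk (skip (insAt Θ)) u))

  hsubF-renF : ∀ {Π α Γ Γ' Θ} {i : Ins α Γ Γ'} {ρ : Ren Θ Γ'} {ρ' : Ren Θ Γ}
             → Avoids i ρ ρ' → (u : Nf Γ α) (F : Form Π Θ) → hsubF i u (renF ρ F) ≡ renF ρ' F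
  hsubF-renF av u botF = refl
  hsubF-renF av u topF = refl
  hsubF-renF av u (A ∧F B) = cong₂ _∧F_ (hsubF-renF av u A) (hsubF-renF av u B)
  hsubF-renF av u (A ∨F B) = cong₂ _∨F_ (hsubF-renF av u A) (hsubF-renF av u B)
  hsubF-renF av u (A ⊃F B) = cong₂ _⊃F_ (hsubF-renF av u A) (hsubF-renF av u B)
  hsubF-renF av u (allF β C) = cong (allF β) (hsubF-renF (Avoids-there av) (wk u) C)
  hsubF-renF av u (exF β C) = cong (exF β) (hsubF-renF (Avoids-there av) (wk u) C)
  hsubF-renF av u (nabF β C) = cong (nabF β) (hsubF-renF (Avoids-there av) (wk u) C)
  hsubF-renF av u (atom p ts) = cong (atom p) (trans (map-∘ ts) (map-cong ts (hsub-renNf av u)))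
  hsubF-renF av u (patom P ts) = cong (patom P) (trans (map-∘ ts) (map-cong ts (hsub-renNf av u)))

  Tracks-wkR : ∀ ω {α Γ Γ'} (i : Ins α Γ Γ') → Tracks i (liftIns ω i) (wkR ω) (wkR ω)
  Tracks-wkR [] i x = sym (mapSplit-id (split i x))
  Tracks-wkR (β ∷ ω) i x =
    trans (cong (mapSplit vs) (Tracks-wkR ω i x)) (mapSplit-∘ vs (wkR ω) (split i x))

  Avoids-embL : ∀ ω {α Γ Γ'} (i : Ins α Γ Γ') → Avoids (liftIns ω i) (embL ω) (embL ω)
  Avoids-embL (β ∷ ω) i vz = refl
  Avoids-embL (β ∷ ω) i (vs y) = cong (mapSplit vs) (Avoids-embL ω i y)

  hsubF-instOpen : ∀ ω {Π α Γ Γ'} (i : Ins α Γ Γ') (u : Nf Γ α) (F : Form Π (ω ++ Γ')) (ts : All (Nf Γ') ω)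
    → hsubF i u (instOpen ω F ts) ≡ instOpen ω (hsubF (liftIns ω i) (wkNf ω u) F) (All.map (hsub i u) ts)
  hsubF-instOpen [] i u F [] = cong (λ u' → hsubF i u' F) (sym (wkNf-[] u))
  hsubF-instOpen (β ∷ ω) i u F (t ∷ ts) = begin
      hsubF i u (instOpen ω (subF [] β (wkNf ω t) F) ts)
    ≡⟨ hsubF-instOpen ω i u (subF [] β (wkNf ω t) F) ts ⟩
      instOpen ω (hsubF Lω uω (subF [] β (wkNf ω t) F)) ts'
    ≡⟨ cong (λ G → instOpen ω (hsubF Lω uω G) ts') (subF≡hsubF-here (wkNf ω t) F) ⟩
      instOpen ω (hsubF Lω uω (hsubF here (wkNf ω t) F)) ts'
    ≡⟨ cong (λ G → instOpen ω G ts') (hsubF-hsubF [] Lω uω (wkNf ω t) F) ⟩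
      instOpen ω (hsubF here (hsub Lω uω (wkNf ω t)) (hsubF (there Lω) (wk uω) F)) ts'
    ≡⟨ cong₂ (λ t' u' → instOpen ω (hsubF here t' (hsubF (there Lω) u' F)) ts')
         (sym (renNf-hsub (Tracks-wkR ω i) u t)) (sym (wkNf-∷ ω u)) ⟩
      instOpen ω (hsubF here (wkNf ω (hsub i u t)) (hsubF (there Lω) (wkNf (β ∷ ω) u) F)) ts'
    ≡⟨ cong (λ G → instOpen ω G ts') (sym (subF≡hsubF-here (wkNf ω (hsub i u t)) _)) ⟩
      instOpen ω (subF [] β (wkNf ω (hsub i u t)) (hsubF (there Lω) (wkNf (β ∷ ω) u) F)) ts'
    ∎
    where
      Lω = liftIns ω i
      uω = wkNf ω u
      ts' = All.map (hsub i u) ts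

  hsubF-inst : ∀ ω {Π α Γ Γ'} (i : Ins α Γ Γ') (u : Nf Γ α) (S : Form Π ω) (ts : All (Nf Γ') ω)
             → hsubF i u (inst ω S ts) ≡ inst ω S (All.map (hsub i u) ts)
  hsubF-inst ω i u S ts = trans (hsubF-instOpen ω i u (renF (embL ω) S) ts)
    (cong (λ G → instOpen ω G (All.map (hsub i u) ts)) (hsubF-renF (Avoids-embL ω i) (wkNf ω u) S))

  subF-inst : ∀ ω {Π} Γ₀ α {Δ} (u : Nf Δ α) (S : Form Π ω) (ts : All (Nf (Γ₀ ++ α ∷ Δ)) ω)
            → subF Γ₀ α u (inst ω S ts) ≡ inst ω S (All.map (subNf Γ₀ α u) ts)
  subF-inst ω Γ₀ α u S ts = begin
      subF Γ₀ α u (inst ω S ts)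
    ≡⟨ subF≡hsubF Γ₀ α u (inst ω S ts) ⟩
      hsubF (insAt Γ₀) (wkNf Γ₀ u) (inst ω S ts)
    ≡⟨ hsubF-inst ω (insAt Γ₀) (wkNf Γ₀ u) S ts ⟩
      inst ω S (All.map (hsub (insAt Γ₀) (wkNf Γ₀ u)) ts)
    ≡⟨ cong (inst ω S) (sym (map-cong ts (subNf≡hsub Γ₀ α u))) ⟩
      inst ω S (All.map (subNf Γ₀ α u) ts)
    ∎

  CommutesWithSubst : ∀ {ω} → PVal ω → Set
  CommutesWithSubst {ω} v = ∀ Γ₀ α {Δ} (u : Nf Δ α) (ts : All (Nf (Γ₀ ++ α ∷ Δ)) ω)
                          → v (All.map (subNf Γ₀ α u) ts) ≡ subF Γ₀ α u (v ts)

  predVal-commutes : ∀ {ω} (p : Pred ω) → CommutesWithSubst (predVal p)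
  predVal-commutes p Γ₀ α u ts = refl

  invVal-commutes : ∀ {ω} (S : Form [] ω) → CommutesWithSubst (invVal S)
  invVal-commutes {ω} S Γ₀ α u ts = sym (subF-inst ω Γ₀ α u S ts)

  substP-subF : ∀ {ω} {v : PVal ω} → CommutesWithSubst v
              → ∀ Γ₀ α {Δ} (u : Nf Δ α) (C : Form (ω ∷ []) (Γ₀ ++ α ∷ Δ))
              → substP (subF Γ₀ α u C) v ≡ subF Γ₀ α u (substP C v)
  substP-subF comm Γ₀ α u botF = refl
  substP-subF comm Γ₀ α u topF = refl
  substP-subF comm Γ₀ α u (A ∧F B) = cong₂ _∧F_ (substP-subF comm Γ₀ α u A) (substP-subF comm Γ₀ α u B)
  substP-subF comm Γ₀ α u (A ∨F B) = cong₂ _∨F_ (substP-subF comm Γ₀ α u A) (substP-subF comm Γ₀ α u B)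
  substP-subF comm Γ₀ α u (A ⊃F B) = cong₂ _⊃F_ (substP-subF comm Γ₀ α u A) (substP-subF comm Γ₀ α u B)
  substP-subF comm Γ₀ α u (allF β C) = cong (allF β) (substP-subF comm (β ∷ Γ₀) α u C)
  substP-subF comm Γ₀ α u (exF β C) = cong (exF β) (substP-subF comm (β ∷ Γ₀) α u C)
  substP-subF comm Γ₀ α u (nabF β C) = cong (nabF β) (substP-subF comm (β ∷ Γ₀) α u C)
  substP-subF comm Γ₀ α u (atom p ts) = refl
  substP-subF comm Γ₀ α u (patom vz ts) = comm Γ₀ α u ts

  substP-[/0] : ∀ {ω α} {v : PVal ω} → CommutesWithSubst v → (C : Form (ω ∷ []) (α ∷ [])) (t : Nf [] α)
              → substP (C [ t /0]) v ≡ substP C v [ t /0]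
  substP-[/0] comm C t = substP-subF comm [] _ t C

  substP-holeFree : ∀ {ω Γ} (C : Form (ω ∷ []) Γ) (v v' : PVal ω) → HoleFree C → substP C v ≡ substP C v'
  substP-holeFree botF v v' h = refl
  substP-holeFree topF v v' h = refl
  substP-holeFree (A ∧F B) v v' (hA , hB) = cong₂ _∧F_ (substP-holeFree A v v' hA) (substP-holeFree B v v' hB)
  substP-holeFree (A ∨F B) v v' (hA , hB) = cong₂ _∨F_ (substP-holeFree A v v' hA) (substP-holeFree B v v' hB)
  substP-holeFree (A ⊃F B) v v' (hA , hB) = cong₂ _⊃F_ (substP-holeFree A v v' hA) (substP-holeFree B v v' hB)
  substP-holeFree (allF β C) v v' h = cong (allF β) (substP-holeFree C v v' h)
  substP-holeFree (exF β C) v v' h = cong (exF β) (substP-holeFree C v v' h)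
  substP-holeFree (nabF β C) v v' h = cong (nabF β) (substP-holeFree C v v' h)
  substP-holeFree (atom p ts) v v' h = refl
  substP-holeFree (patom (vs ()) ts) v v' h

  HoleFree-subF : ∀ {ω} Γ₀ α {Δ} (u : Nf Δ α) (C : Form (ω ∷ []) (Γ₀ ++ α ∷ Δ)) → HoleFree C → HoleFree (subF Γ₀ α u C)
  HoleFree-subF Γ₀ α u botF h = tt
  HoleFree-subF Γ₀ α u topF h = tt
  HoleFree-subF Γ₀ α u (A ∧F B) (hA , hB) = HoleFree-subF Γ₀ α u A hA , HoleFree-subF Γ₀ α u B hB
  HoleFree-subF Γ₀ α u (A ∨F B) (hA , hB) = HoleFree-subF Γ₀ α u A hA , HoleFree-subF Γ₀ α u B hB
  HoleFree-subF Γ₀ α u (A ⊃F B) (hA , hB) = HoleFree-subF Γ₀ α u A hA , HoleFree-subF Γ₀ α u B hB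
  HoleFree-subF Γ₀ α u (allF β C) h = HoleFree-subF (β ∷ Γ₀) α u C h
  HoleFree-subF Γ₀ α u (exF β C) h = HoleFree-subF (β ∷ Γ₀) α u C h
  HoleFree-subF Γ₀ α u (nabF β C) h = HoleFree-subF (β ∷ Γ₀) α u C h
  HoleFree-subF Γ₀ α u (atom p ts) h = tt
  HoleFree-subF Γ₀ α u (patom (vs ()) ts) h

  Positive-subF : ∀ {ω} Γ₀ α {Δ} (u : Nf Δ α) (C : Form (ω ∷ []) (Γ₀ ++ α ∷ Δ)) → Positive C → Positive (subF Γ₀ α u C)
  Positive-subF Γ₀ α u botF h = tt
  Positive-subF Γ₀ α u topF h = tt
  Positive-subF Γ₀ α u (A ∧F B) (hA , hB) = Positive-subF Γ₀ α u A hA , Positive-subF Γ₀ α u B hB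
  Positive-subF Γ₀ α u (A ∨F B) (hA , hB) = Positive-subF Γ₀ α u A hA , Positive-subF Γ₀ α u B hB
  Positive-subF Γ₀ α u (A ⊃F B) (hA , hB) = HoleFree-subF Γ₀ α u A hA , Positive-subF Γ₀ α u B hB
  Positive-subF Γ₀ α u (allF β C) h = Positive-subF (β ∷ Γ₀) α u C h
  Positive-subF Γ₀ α u (exF β C) h = Positive-subF (β ∷ Γ₀) α u C h
  Positive-subF Γ₀ α u (nabF β C) h = Positive-subF (β ∷ Γ₀) α u C h
  Positive-subF Γ₀ α u (atom p ts) h = tt
  Positive-subF Γ₀ α u (patom P ts) h = tt

  depth : ∀ {Π Γ} → Form Π Γ → ℕ
  depth botF = 0
  depth topF = 0
  depth (A ∧F B) = suc (depth A ⊔ depth B)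
  depth (A ∨F B) = suc (depth A ⊔ depth B)
  depth (A ⊃F B) = suc (depth A ⊔ depth B)
  depth (allF β C) = suc (depth C)
  depth (exF β C) = suc (depth C)
  depth (nabF β C) = suc (depth C)
  depth (atom p ts) = 0
  depth (patom P ts) = 0

  depth-subF : ∀ {Π} Γ₀ α {Δ} (u : Nf Δ α) (F : Form Π (Γ₀ ++ α ∷ Δ)) → depth (subF Γ₀ α u F) ≡ depth F
  depth-subF Γ₀ α u botF = refl
  depth-subF Γ₀ α u topF = refl
  depth-subF Γ₀ α u (A ∧F B) = cong₂ (λ a b → suc (a ⊔ b)) (depth-subF Γ₀ α u A) (depth-subF Γ₀ α u B)
  depth-subF Γ₀ α u (A ∨F B) = cong₂ (λ a b → suc (a ⊔ b)) (depth-subF Γ₀ α u A) (depth-subF Γ₀ α u B)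
  depth-subF Γ₀ α u (A ⊃F B) = cong₂ (λ a b → suc (a ⊔ b)) (depth-subF Γ₀ α u A) (depth-subF Γ₀ α u B)
  depth-subF Γ₀ α u (allF β C) = cong suc (depth-subF (β ∷ Γ₀) α u C)
  depth-subF Γ₀ α u (exF β C) = cong suc (depth-subF (β ∷ Γ₀) α u C)
  depth-subF Γ₀ α u (nabF β C) = cong suc (depth-subF (β ∷ Γ₀) α u C)
  depth-subF Γ₀ α u (atom p ts) = refl
  depth-subF Γ₀ α u (patom P ts) = refl

  depth-[/0]-< : ∀ {Π α n} (C : Form Π (α ∷ [])) (t : Nf [] α) → suc (depth C) < suc n → depth (C [ t /0]) < n
  depth-[/0]-< {α = α} C t (s≤s d<n) = subst (_< _) (sym (depth-subF [] α t C)) d<n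

  permArgs-id : ∀ {Γ ω} (ts : All (Nf Γ) ω) → permArgs (λ α n → n) ts ≡ ts
  permArgs-id ts = trans (map-cong ts permNf-id) (map-id ts)
    where
      mutual
        permNf-id : ∀ {Γ α} (t : Nf Γ α) → permNf (λ α n → n) t ≡ t
        permNf-id (lam t) = cong lam (permNf-id t)
        permNf-id (ne h sp) = cong₂ ne (permH-id h) (permSp-id sp)

        permSp-id : ∀ {Γ α b} (sp : Sp Γ α b) → permSp (λ α n → n) sp ≡ sp
        permSp-id sε = refl
        permSp-id (t ▹ sp) = cong₂ _▹_ (permNf-id t) (permSp-id sp)

        permH-id : ∀ {Γ α} (h : Head Γ α) → permH (λ α n → n) h ≡ h
        permH-id (var x) = refl
        permH-id (con c) = refl
        permH-id (nom n) = refl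

  module Derivations {DI : Set} (D : DI → Clause) {II : Set} (I : II → IClause) where
    open Calculus D I

    cut : ∀ {Δ Γ A C} → Δ ⊢ A → A ∷ Γ ⊢ C → Δ ++ Γ ⊢ C
    cut {Δ} {Γ} {A} {C} d e =
      subst (λ Δ' → Δ' ++ Γ ⊢ C) (++-identityʳ Δ) (mcut 1 (λ _ → Δ) (λ _ → A) (λ _ → d) e)

    ∧-mono : ∀ {A A' B B'} → A ∷ [] ⊢ A' → B ∷ [] ⊢ B' → (A ∧F B) ∷ [] ⊢ A' ∧F B'
    ∧-mono dA dB = andR (andL₁ dA) (andL₂ dB)

    ∨-mono : ∀ {A A' B B'} → A ∷ [] ⊢ A' → B ∷ [] ⊢ B' → (A ∨F B) ∷ [] ⊢ A' ∨F B'
    ∨-mono dA dB = orL (orR₁ dA) (orR₂ dB)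

    ⊃-mono : ∀ {A A' B B'} → A' ∷ [] ⊢ A → B ∷ [] ⊢ B' → (A ⊃F B) ∷ [] ⊢ A' ⊃F B'
    ⊃-mono dA dB = impR (exch (swap _ _ ↭-refl) (impL dA (exch (swap _ _ ↭-refl) (wL dB))))

    ∀-mono : ∀ {α C C'} → ((t : Nf [] α) → C [ t /0] ∷ [] ⊢ C' [ t /0]) → allF α C ∷ [] ⊢ allF α C'
    ∀-mono d = allR (λ t → allL t (d t))

    ∃-mono : ∀ {α C C'} → ((t : Nf [] α) → C [ t /0] ∷ [] ⊢ C' [ t /0]) → exF α C ∷ [] ⊢ exF α C'
    ∃-mono d = exL (λ t → exR t (d t))

    ∇-mono : ∀ {α C C'} → ((n : ℕ) → C [ nomTm α n /0] ∷ [] ⊢ C' [ nomTm α n /0]) → nabF α C ∷ [] ⊢ nabF α C'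
    ∇-mono {α} {C} {C'} d =
      nabR n (λ n∈C' → suc-maxList-∉ α both (∈-++⁺ʳ (noms C) n∈C'))
        (nabL n (λ n∈C → suc-maxList-∉ α both (∈-++⁺ˡ n∈C)) (d n))
      where
        both = noms C ++ noms C'
        n = suc (maxList (map proj₂ both))

    ⊢-refl-< : ∀ n (F : GF) → depth F < n → F ∷ [] ⊢ F
    ⊢-refl-< (suc n) botF _ = botL
    ⊢-refl-< (suc n) topF _ = topR
    ⊢-refl-< (suc n) (A ∧F B) (s≤s d<n) = ∧-mono (⊢-refl-< n A (m⊔n<o⇒m<o _ _ d<n)) (⊢-refl-< n B (m⊔n<o⇒n<o _ _ d<n))
    ⊢-refl-< (suc n) (A ∨F B) (s≤s d<n) = ∨-mono (⊢-refl-< n A (m⊔n<o⇒m<o _ _ d<n)) (⊢-refl-< n B (m⊔n<o⇒n<o _ _ d<n))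
    ⊢-refl-< (suc n) (A ⊃F B) (s≤s d<n) = ⊃-mono (⊢-refl-< n A (m⊔n<o⇒m<o _ _ d<n)) (⊢-refl-< n B (m⊔n<o⇒n<o _ _ d<n))
    ⊢-refl-< (suc n) (allF α C) d<n = ∀-mono (λ t → ⊢-refl-< n (C [ t /0]) (depth-[/0]-< C t d<n))
    ⊢-refl-< (suc n) (exF α C) d<n = ∃-mono (λ t → ⊢-refl-< n (C [ t /0]) (depth-[/0]-< C t d<n))
    ⊢-refl-< (suc n) (nabF α C) d<n =
      ∇-mono (λ k → ⊢-refl-< n (C [ nomTm α k /0]) (depth-[/0]-< C (nomTm α k) d<n))
    ⊢-refl-< (suc n) (atom p ts) _ =
      subst (λ ts' → atom p ts ∷ [] ⊢ atom p ts') (permArgs-id ts) (ax p ts (λ _ → ↔-id ℕ) (λ _ _ n∈ts → n∈ts))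

    ⊢-refl : (F : GF) → F ∷ [] ⊢ F
    ⊢-refl F = ⊢-refl-< (suc (depth F)) F ≤-refl

    module _ {ω} {v v' : PVal ω} (comm : CommutesWithSubst v) (comm' : CommutesWithSubst v')
             (v⊢v' : (ts : All (Nf []) ω) → v ts ∷ [] ⊢ v' ts) where

      mutual
        monotone-< : ∀ n (C : Form (ω ∷ []) []) → depth C < n → Positive C → substP C v ∷ [] ⊢ substP C v'
        monotone-< (suc n) botF _ _ = botL
        monotone-< (suc n) topF _ _ = topR
        monotone-< (suc n) (A ∧F B) (s≤s d<n) (posA , posB) =
          ∧-mono (monotone-< n A (m⊔n<o⇒m<o _ _ d<n) posA) (monotone-< n B (m⊔n<o⇒n<o _ _ d<n) posB)
        monotone-< (suc n) (A ∨F B) (s≤s d<n) (posA , posB) =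
          ∨-mono (monotone-< n A (m⊔n<o⇒m<o _ _ d<n) posA) (monotone-< n B (m⊔n<o⇒n<o _ _ d<n) posB)
        monotone-< (suc n) (A ⊃F B) (s≤s d<n) (holeFreeA , posB) =
          ⊃-mono (subst (λ G → substP A v' ∷ [] ⊢ G) (substP-holeFree A v' v holeFreeA) (⊢-refl (substP A v')))
                 (monotone-< n B (m⊔n<o⇒n<o _ _ d<n) posB)
        monotone-< (suc n) (allF α C) d<n pos = ∀-mono (monotone-[/0] n C d<n pos)
        monotone-< (suc n) (exF α C) d<n pos = ∃-mono (monotone-[/0] n C d<n pos)
        monotone-< (suc n) (nabF α C) d<n pos = ∇-mono (λ k → monotone-[/0] n C d<n pos (nomTm α k))
        monotone-< (suc n) (atom p ts) _ _ = ⊢-refl (atom p ts)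
        monotone-< (suc n) (patom vz ts) _ _ = v⊢v' ts

        monotone-[/0] : ∀ n {α} (C : Form (ω ∷ []) (α ∷ [])) → suc (depth C) < suc n → Positive C
                      → (t : Nf [] α) → substP C v [ t /0] ∷ [] ⊢ substP C v' [ t /0]
        monotone-[/0] n {α} C d<n pos t =
          subst₂ (λ F G → F ∷ [] ⊢ G) (substP-[/0] comm C t) (substP-[/0] comm' C t)
            (monotone-< n (C [ t /0]) (depth-[/0]-< C t d<n) (Positive-subF [] α t C pos))

      monotone : (C : Form (ω ∷ []) []) → Positive C → substP C v ∷ [] ⊢ substP C v'
      monotone C = monotone-< (suc (depth C)) C ≤-refl

mainTheorem9 : {nb : ℕ} (Fun : FTy nb → Set) (Pred : List (FTy nb) → Set) →
    let open LD Fun Pred in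
    (L : LvlAssign) {DI : Set} (D : DI → Clause) {II : Set} (I : II → IClause) →
    ValidD D → WeaklyStratified L D →
    ValidI D I → StrictlyStratifiedI L I →
    let open Calculus D I in
    (j : II) (S : Form [] (IClause.ω (I j))) →
    ((us : All (Nf []) (IClause.ω (I j))) →
      BApp (I j) (invVal S) us ∷ [] ⊢ instG (IClause.ω (I j)) S us) →
    (C : Form (IClause.ω (I j) ∷ []) []) →
    NoPred (pidI (I j)) C → Positive C →
    (Δ : List GF) →
    Δ ⊢ substP C (predVal (IClause.p (I j))) →
    Δ ⊢ substP C (invVal S)
mainTheorem9 Fun Pred _ D I _ _ _ _ j S ΠS C _ pos Δ Ξ =
  subst (_⊢ substP C (invVal S)) (++-identityʳ Δ) (cut Ξ Cp⊢CS)
  where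
    open LD Fun Pred
    open Calculus D I
    open Metatheory Fun Pred
    open Derivations D I

    p⊢S : (ts : All (Nf []) (IClause.ω (I j))) → atom (IClause.p (I j)) ts ∷ [] ⊢ invVal S ts
    p⊢S ts = muL j ts S ΠS (⊢-refl (invVal S ts))

    Cp⊢CS : substP C (predVal (IClause.p (I j))) ∷ [] ⊢ substP C (invVal S)
    Cp⊢CS = monotone (predVal-commutes (IClause.p (I j))) (invVal-commutes S) p⊢S C pos
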